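{- Let $G=(V,E)$ be a directed graph (multigraph allowed) with nonnegative edge weights $c:E\to\mathbb{R}_{\ge 0}$, a source $s\in V$, a target $t\in V$, and $k\in\mathbb{N}$, such that for every $v\in V$ there is an $s$-$v$ path and a $v$-$t$ path in $G$. Then the basic algorithm described in the context computes the $k$ shortest simple $s$-$t$ paths of $G$, i.e., it outputs a set $P$ of $k$ simple $s$-$t$ paths such that $c(p)\le c(p')$ for every $p\in P$ and every simple $s$-$t$ path $p'\notin P$.
   Context: A path is a sequence of edges $(e_1,\dots,e_r)$ with $e_i=(v_i,w_i)$ and $w_i=v_{i+1}$; it is simple if it visits no node twice; its length $c(p)$ is the sum of its edge weights. For a node set $U$, $G-U$ denotes the subgraph of $G$ induced by $V\setminus U$; for a path $q$, $G-q$ means $G$ minus the nodes of $q$. Shortest path trees. For a subgraph $H$ of $G$ containing $t$, a shortest path (SP) tree $T$ of $H$ is a subgraph in which every node $v$ having a $v$-$t$ path in $H$ has exactly one outgoing edge, lying on a shortest $v$-$t$ path of $H$, and every other node has no outgoing edge (written $v\notin T$). $d_T(v)$ is the length of the unique $v$-$t$ path in $T$. An edge $e=(v,w)\notin T$ is a sidetrack w.r.t. $T$, with sidetrack cost $\delta_T(e)=c(e)+d_T(w)-d_T(v)$. Sidetrack sequences. A sequence $(e_1,\dots,e_r)$ of edges, each $e_i$ associated with an SP tree $T_{e_i}$, together with an initial SP tree $T_0$ of $G$, represents the walk obtained by starting at $s$, following $T_0$ to the tail of $e_1$, and for each $i$ traversing $e_i$ and then following $T_{e_i}$ to the tail of $e_{i+1}$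 (or to $t$ if $i=r$). The empty sequence represents the $s$-$t$ path $p_0$ in $T_0$. For a represented path $p$ with $r\ge1$, the last sidetrack $e_r$ is the deviation edge, its tail is the deviation node, the prefix path $\mathrm{pref}(p)$ is the part of $p$ from $s$ up to the point where $e_r$ is traversed (the deviation node), and the suffix path $\mathrm{suff}(p)$ is the part of $p$ after $e_r$, from the head of $e_r$ to $t$. For $r=0$, $\mathrm{suff}(p_0)=p_0$. Let $T_{e_0}:=T_0$. Basic algorithm. Compute an SP tree $T_0$ of $G$ (Dijkstra's algorithm). Push the empty sequence into a priority queue $Q$ keyed by path length. Repeatedly extract a minimum sequence $(e_1,\dots,e_r)$ representing path $p$, until $k$ simple paths have been output: (i) If $p$ is simple: output $p$; for every edge $e=(u,v)$ that is a sidetrack w.r.t. $T_{e_r}$ with $u$ on $\mathrm{suff}(p)$, $u\neq t$, and $v\in T_{e_r}$, push $(e_1,\dots,e_r,e)$ with $T_e:=T_{e_r}$ and key $c(p)+\delta_{T_e}(e)$. (ii) If $p$ is not simple: let $e_r=(v,w)$; compute an SP tree $T$ of $G-\mathrm{pref}(p)$. If $w\notin T$, discard $p$; otherwise push $(e_1,\dots,e_r)$ again with $T_{e_r}$ replaced by $T$ and key $c(\mathrm{pref}(p))+c(e_r)+d_T(w)$. -}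

module Defs where

open import Data.Nat using (ℕ; zero; suc; _<_)
open import Data.Fin using (Fin; _≟_)
open import Data.Fin.Properties using (all?)
open import Data.List using (List; []; _∷_; _++_; map; length; [_]; concatMap)
open import Data.List.Base using (allFin)
open import Data.List.Relation.Unary.All using (All)
open import Data.List.Relation.Unary.Unique.Propositional using (Unique)
open import Data.List.Membership.Propositional using (_∈_; _∉_)
import Data.List.Membership.DecPropositional as DecMem
open import Data.Maybe using (Maybe; just; nothing; _>>=_)
import Data.Maybe.Properties as MaybeP
open import Data.Product using (Σ; ∃; _×_; _,_; proj₁; proj₂)
open import Data.Sum using (_⊎_)
open import Relation.Nullary using (¬_; yes; no)
open import Relation.Binary.PropositionalEquality using (_≡_; _≢_)
open import Algebra.Structures using (IsCommutativeRing)
open import Relation.Binary.Structures using (IsTotalOrder)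

-- The real numbers, given axiomatically as an arbitrary complete ordered
-- field (any model is isomorphic to ℝ).  Only used as the weight domain.

record OrderedReals : Set₁ where
  infixl 6 _+_ _-_
  infixl 7 _*_
  infix 4 _≤_
  field
    Carrier : Set
    _+_ _*_ : Carrier → Carrier → Carrier
    -_ : Carrier → Carrier
    0# 1# : Carrier
    _≤_ : Carrier → Carrier → Set
    isCommutativeRing : IsCommutativeRing _≡_ _+_ _*_ -_ 0# 1#
    0≢1 : 0# ≢ 1#
    inverse : ∀ x → x ≢ 0# → ∃ λ y → x * y ≡ 1#
    isTotalOrder : IsTotalOrder _≡_ _≤_
    +-mono-≤ : ∀ x y z → x ≤ y → x + z ≤ y + z
    *-nonneg : ∀ x y → 0# ≤ x → 0# ≤ y → 0# ≤ x * y
    complete : (P : Carrier → Set) → (∃ λ x → P x) →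
               (∃ λ b → ∀ x → P x → x ≤ b) →
               ∃ λ l → (∀ x → P x → x ≤ l) × (∀ b → (∀ x → P x → x ≤ b) → l ≤ b)

  _-_ : Carrier → Carrier → Carrier
  x - y = x + (- y)

-- Weighted directed multigraphs: nodes Fin n, edges Fin m (parallel
-- edges and loops allowed), edge e goes from src e to tgt e.

record WGraph (ℝ : OrderedReals) : Set where
  field
    n m : ℕ
    src tgt : Fin m → Fin n
    c : Fin m → OrderedReals.Carrier ℝ

module Alg (ℝ : OrderedReals) (G : WGraph ℝ) where
  open OrderedReals ℝ
  open WGraph G

  Node : Set
  Node = Fin n

  Edge : Set
  Edge = Fin m

  IsPath : Node → List Edge → Node → Set
  IsPath v [] w = v ≡ w
  IsPath v (e ∷ es) w = src e ≡ v × IsPath (tgt e) es w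

  nodes : Node → List Edge → List Node
  nodes v es = v ∷ map tgt es

  Simple : Node → List Edge → Set
  Simple v es = Unique (nodes v es)

  cost : List Edge → Carrier
  cost [] = 0#
  cost (e ∷ es) = c e + cost es

  PathIn : List Node → Node → List Edge → Node → Set
  PathIn U v es w = IsPath v es w × All (λ x → x ∉ U) (nodes v es)

  -- an SP tree is given by the (at most one) outgoing edge of each node
  Tree : Set
  Tree = Node → Maybe Edge

  follow : ℕ → Tree → Node → Node → Maybe (List Edge)
  follow fuel T x y with x ≟ y
  ... | yes _ = just []
  follow zero T x y | no _ = nothing
  follow (suc f) T x y | no _ =
    T x >>= λ e → follow f T (tgt e) y >>= λ q → just (e ∷ q)

  module _ (s t : Node) (k : ℕ) where

    -- the unique v-t path in T (nothing iff v ∉ T)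
    treePath : Tree → Node → Maybe (List Edge)
    treePath T v = follow n T v t

    dT : Tree → Node → Maybe Carrier
    dT T v = treePath T v >>= λ q → just (cost q)

    SPTree : List Node → Tree → Set
    SPTree U T =
      (T t ≡ nothing) ×
      (∀ v → (∃ λ q → PathIn U v q t) →
        ∃ λ q → treePath T v ≡ just q × PathIn U v q t ×
                (∀ q' → PathIn U v q' t → cost q ≤ cost q')) ×
      (∀ v → ¬ (∃ λ q → PathIn U v q t) → T v ≡ nothing)

    -- sidetrack sequences (each edge with its associated SP tree)
    Seq : Set
    Seq = List (Edge × Tree)

    -- walk obtained by starting at x, following T, then the sidetracks
    -- in seq, and finally following the last tree to y
    upTo : Tree → Node → Seq → Node → Maybe (List Edge)
    upTo T x [] y = follow n T x y
    upTo T x ((e , Te) ∷ rest) y =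
      follow n T x (src e) >>= λ q →
      upTo Te (tgt e) rest y >>= λ r → just (q ++ (e ∷ r))

    rep : Tree → Seq → Maybe (List Edge)
    rep T0 sq = upTo T0 s sq t

    -- T_{e_r} and the start node of suff(p)  (T0 and s when r = 0)
    lastInfo : Tree → Node → Seq → Tree × Node
    lastInfo T x [] = (T , x)
    lastInfo T x ((e , Te) ∷ rest) = lastInfo Te (tgt e) rest

    Entry : Set
    Entry = Seq × Carrier

    -- candidate new entry for edge e in case (i):
    -- T = T_{e_r}, sfn = nodes of suff(p), cp = c(p)
    pushOne : Seq → Carrier → Tree → List Node → Edge → List Entry
    pushOne sq cp T sfn e with MaybeP.≡-dec _≟_ (T (src e)) (just e)
    ... | yes _ = []
    ... | no _ with DecMem._∈?_ _≟_ (src e) sfn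
    ...   | no _ = []
    ...   | yes _ with src e ≟ t
    ...     | yes _ = []
    ...     | no _ with dT T (tgt e) | dT T (src e)
    ...       | just dw | just du = [ (sq ++ [ (e , T) ] , cp + (c e + dw - du)) ]
    ...       | _ | _ = []

    pushAll : Seq → Carrier → Tree → List Node → List Entry
    pushAll sq cp T sfn = concatMap (pushOne sq cp T sfn) (allFin m)

    record State : Set where
      constructor st
      field
        queue : List Entry
        out : List (List Edge)

    Minimal : Carrier → List Entry → Set
    Minimal key Q = All (λ y → key ≤ proj₂ y) Q

    -- one iteration of the basic algorithm (nondeterministic: choice of
    -- minimum entry among ties, and choice of the SP tree in (ii))
    data Step (T0 : Tree) : State → State → Set where
      simple : ∀ (Q₁ Q₂ : List Entry) (out : List (List Edge)) (sq : Seq) (key : Carrier) (p sf : List Edge) →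
        length out < k → Minimal key (Q₁ ++ Q₂) →
        rep T0 sq ≡ just p → Simple s p →
        follow n (proj₁ (lastInfo T0 s sq)) (proj₂ (lastInfo T0 s sq)) t ≡ just sf →
        Step T0 (st (Q₁ ++ ((sq , key) ∷ Q₂)) (out))
             (st (Q₁ ++ Q₂ ++ pushAll sq (cost p) (proj₁ (lastInfo T0 s sq))
                                    (nodes (proj₂ (lastInfo T0 s sq)) sf))
                 (out ++ [ p ]))
      discard : ∀ (Q₁ Q₂ : List Entry) (out : List (List Edge)) (ini : Seq) (e : Edge) (Te : Tree) (key : Carrier) (p pr : List Edge) (T : Tree) →
        length out < k → Minimal key (Q₁ ++ Q₂) →
        rep T0 (ini ++ [ (e , Te) ]) ≡ just p → ¬ Simple s p →
        upTo T0 s ini (src e) ≡ just pr →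
        SPTree (nodes s pr) T →
        (tgt e ∈ nodes s pr ⊎ dT T (tgt e) ≡ nothing) →
        Step T0 (st (Q₁ ++ ((ini ++ [ (e , Te) ] , key) ∷ Q₂)) (out))
             (st (Q₁ ++ Q₂) (out))
      repush : ∀ (Q₁ Q₂ : List Entry) (out : List (List Edge)) (ini : Seq) (e : Edge) (Te : Tree) (key : Carrier) (p pr : List Edge) (T : Tree) (d : Carrier) →
        length out < k → Minimal key (Q₁ ++ Q₂) →
        rep T0 (ini ++ [ (e , Te) ]) ≡ just p → ¬ Simple s p →
        upTo T0 s ini (src e) ≡ just pr →
        SPTree (nodes s pr) T →
        tgt e ∉ nodes s pr → dT T (tgt e) ≡ just d →
        Step T0 (st (Q₁ ++ ((ini ++ [ (e , Te) ] , key) ∷ Q₂)) (out))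
             (st (Q₁ ++ Q₂ ++ [ (ini ++ [ (e , T) ] , cost pr + c e + d) ]) (out))

    KShortest : List (List Edge) → Set
    KShortest P =
      length P ≡ k × Unique P ×
      All (λ p → IsPath s p t × Simple s p) P ×
      (∀ p p' → p ∈ P → IsPath s p' t → Simple s p' → p' ∉ P → cost p ≤ cost p')

    -- every run from st terminates (after finitely many iterations, with
    -- k outputs) and outputs k shortest simple s-t paths
    data AllRunsCorrect (T0 : Tree) : State → Set where
      done : ∀ {st} → length (State.out st) ≡ k → KShortest (State.out st) →
        AllRunsCorrect T0 st
      step : ∀ {st} → length (State.out st) < k →
        (∃ λ st' → Step T0 st st') →
        (∀ st' → Step T0 st st' → AllRunsCorrect T0 st') →
        AllRunsCorrect T0 st

    initState : List Edge → State
    initState p0 = (st ([ ([] , cost p0) ]) ([]))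

module Submission where

-- The proof has two independent halves.
--   * Shortest-path trees exist (module Dijkstra): for nonnegative weights
--     and every forbidden node set U there is an SP tree of G - U.  This is
--     the only place where nonnegativity of the weights is needed, and it is
--     what makes step (ii) of every iteration executable.
--   * The queue invariant (module Correctness): every queue entry is
--     well formed (its key is the length of the walk it represents, and that
--     walk extends a fixed prefix ending in the deviation edge); the prefixes
--     of distinct entries are incomparable and no output path extends one of
--     them; and every simple s-t path not yet output extends the prefix of an
--     entry whose key is at most its length.  Extracting a minimum entry thus
--     yields a shortest remaining simple path, and every transition preserves
--     the invariant.  A transition either outputs a path or, with the output
--     unchanged, strictly decreases the weight of the queue (non-simple
--     entries weigh 2, simple ones 1), so runs terminate; and while fewer
--     than k paths are output, a simple path not yet output exists, so the
--     queue is nonempty and some transition is possible.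

open import Defs
open import Data.Nat using (ℕ; zero; suc; _<?_) renaming (_≤_ to _≤ℕ_; _<_ to _<ℕ_)
import Data.Nat as N
import Data.Nat.Properties as NP
open import Data.Nat.Induction using (<-wellFounded)
open import Induction.WellFounded using (Acc; acc)
import Data.Product.Relation.Binary.Lex.Strict as Lex
open import Data.Fin using (Fin; _≟_)
open import Data.List using (List; []; _∷_; _++_; map; length; [_]; concatMap; allFin; filter)
import Data.List.Properties as LP
open import Data.List.Relation.Unary.All using (All; []; _∷_)
import Data.List.Relation.Unary.All as All
import Data.List.Relation.Unary.All.Properties as AllP
import Data.List.Relation.Unary.Any.Properties as AnyP
import Data.List.Relation.Unary.AllPairs.Properties as AllPairsP
import Data.Maybe.Properties as MaybeP
open import Data.List.Relation.Unary.Any using (Any; here; there)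
open import Data.List.Relation.Unary.AllPairs using (AllPairs; []; _∷_)
open import Data.List.Relation.Unary.Unique.Propositional using (Unique)
import Data.List.Relation.Unary.Unique.Propositional.Properties as UniqueP
import Data.List.Relation.Unary.Unique.DecPropositional as UniqueDec
open import Data.List.Membership.Propositional using (_∈_; _∉_)
import Data.List.Membership.Propositional.Properties as MemP
import Data.List.Membership.DecPropositional as DecMem
open import Data.Maybe using (Maybe; just; nothing; _>>=_)
open import Data.Product using (Σ; ∃; ∃₂; _×_; _,_; proj₁; proj₂)
open import Data.Sum using (_⊎_; inj₁; inj₂)
open import Data.Empty using (⊥; ⊥-elim)
open import Relation.Nullary using (¬_; yes; no; Dec)
open import Relation.Nullary.Decidable using (¬?; _×-dec_)
open import Relation.Binary.PropositionalEquality hiding ([_])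
open import Relation.Binary.Structures using (IsTotalOrder)
open import Algebra.Structures using (IsCommutativeRing)

module ListFacts {A : Set} where

  ∈-remove : ∀ {z x : A} ys₁ ys₂ → z ∈ ys₁ ++ x ∷ ys₂ → z ≢ x → z ∈ ys₁ ++ ys₂
  ∈-remove ys₁ ys₂ mem ne with MemP.∈-++⁻ ys₁ mem
  ... | inj₁ m = MemP.∈-++⁺ˡ m
  ... | inj₂ (here p) = ⊥-elim (ne p)
  ... | inj₂ (there m) = MemP.∈-++⁺ʳ ys₁ m

  unique⊆⇒length≤ : (xs ys : List A) → Unique xs → (∀ {z} → z ∈ xs → z ∈ ys) → length xs ≤ℕ length ys
  unique⊆⇒length≤ [] ys u sub = N.z≤n
  unique⊆⇒length≤ (x ∷ xs) ys (x∉xs ∷ u) sub with MemP.∈-∃++ (sub (here refl))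
  ... | ys₁ , ys₂ , refl =
    subst (suc (length xs) ≤ℕ_) (sym (trans (LP.length-++ ys₁) (NP.+-suc (length ys₁) (length ys₂))))
      (N.s≤s (subst (length xs ≤ℕ_) (LP.length-++ ys₁)
        (unique⊆⇒length≤ xs (ys₁ ++ ys₂) u (λ z∈ → ∈-remove ys₁ ys₂ (sub (there z∈))
             (λ z≡x → All.lookup x∉xs z∈ (sym z≡x))))))

  ¬proper-suffix : ∀ (a : List A) e xs → xs ≢ a ++ e ∷ xs
  ¬proper-suffix a e xs eq =
    NP.n≮n (length xs) (subst (suc (length xs) ≤ℕ_) (sym (trans (cong length eq) (LP.length-++ a)))
                              (NP.m≤n+m (suc (length xs)) (length a)))

  unique-++ˡ : ∀ (xs : List A) {ys} → Unique (xs ++ ys) → Unique xs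
  unique-++ˡ [] u = []
  unique-++ˡ (x ∷ xs) (a ∷ u) = AllP.++⁻ˡ xs a ∷ unique-++ˡ xs u

  unique-++-disjoint : ∀ (xs : List A) {ys z} → Unique (xs ++ ys) → z ∈ xs → z ∉ ys
  unique-++-disjoint (x ∷ xs) (a ∷ u) (here refl) z∈ys = All.lookup (AllP.++⁻ʳ xs a) z∈ys refl
  unique-++-disjoint (x ∷ xs) (a ∷ u) (there z∈) z∈ys = unique-++-disjoint xs u z∈ z∈ys

  unique-snoc : ∀ (xs : List A) {x} → Unique xs → x ∉ xs → Unique (xs ++ [ x ])
  unique-snoc [] u nx = [] ∷ []
  unique-snoc (y ∷ xs) (a ∷ u) nx =
    AllP.++⁺ a ((λ y≡x → nx (here (sym y≡x))) ∷ []) ∷ unique-snoc xs u (λ m → nx (there m))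

  snoc≢[] : ∀ (xs : List A) {x} → xs ++ [ x ] ≢ []
  snoc≢[] [] ()
  snoc≢[] (_ ∷ _) ()

  ∈-snoc : ∀ (xs : List A) {x z} → z ∈ xs ++ [ x ] → z ∈ xs ⊎ z ≡ x
  ∈-snoc xs m with MemP.∈-++⁻ xs m
  ... | inj₁ m' = inj₁ m'
  ... | inj₂ (here p) = inj₂ p

  ++-split : ∀ (a₁ x₁ a₂ x₂ : List A) → a₁ ++ x₁ ≡ a₂ ++ x₂ →
    (∃ λ z → a₂ ≡ a₁ ++ z × x₁ ≡ z ++ x₂) ⊎ (∃ λ z → a₁ ≡ a₂ ++ z × x₂ ≡ z ++ x₁)
  ++-split [] x₁ a₂ x₂ eq = inj₁ (a₂ , refl , eq)
  ++-split (y ∷ a₁) x₁ [] x₂ eq = inj₂ (y ∷ a₁ , refl , sym eq)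
  ++-split (y ∷ a₁) x₁ (y' ∷ a₂) x₂ eq with LP.∷-injective eq
  ... | refl , eq' with ++-split a₁ x₁ a₂ x₂ eq'
  ... | inj₁ (z , e₁ , e₂) = inj₁ (z , cong (y ∷_) e₁ , e₂)
  ... | inj₂ (z , e₁ , e₂) = inj₂ (z , cong (y ∷_) e₁ , e₂)

  all-remove : ∀ {P : A → Set} Q₁ {E Q₂} → All P (Q₁ ++ E ∷ Q₂) → P E × All P (Q₁ ++ Q₂)
  all-remove [] (pe ∷ a) = pe , a
  all-remove (x ∷ Q₁) (px ∷ a) with all-remove Q₁ a
  ... | pe , a' = pe , px ∷ a'

  all-insert : ∀ {P : A → Set} Q₁ {E Q₂} → All P (Q₁ ++ Q₂) → P E → All P (Q₁ ++ E ∷ Q₂)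
  all-insert [] a pe = pe ∷ a
  all-insert (x ∷ Q₁) (px ∷ a) pe = px ∷ all-insert Q₁ a pe

  any-remove : ∀ {P : A → Set} Q₁ {E Q₂} → Any P (Q₁ ++ E ∷ Q₂) → P E ⊎ Any P (Q₁ ++ Q₂)
  any-remove [] (here p) = inj₁ p
  any-remove [] (there a) = inj₂ a
  any-remove (x ∷ Q₁) (here p) = inj₂ (here p)
  any-remove (x ∷ Q₁) (there a) with any-remove Q₁ a
  ... | inj₁ p = inj₁ p
  ... | inj₂ a' = inj₂ (there a')

  allPairs-remove : ∀ {R : A → A → Set} → (∀ {x y} → R x y → R y x) → ∀ Q₁ {E Q₂} →
                    AllPairs R (Q₁ ++ E ∷ Q₂) → AllPairs R (Q₁ ++ Q₂) × All (R E) (Q₁ ++ Q₂)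
  allPairs-remove symR [] (a ∷ ap) = ap , a
  allPairs-remove symR (x ∷ Q₁) (a ∷ ap) with allPairs-remove symR Q₁ ap | all-remove Q₁ a
  ... | ap' , ae | rxe , a' = (a' ∷ ap') , (symR rxe ∷ ae)

  all-append : ∀ {P : A → Set} Q₁ Q₂ X → All P (Q₁ ++ Q₂) → All P X → All P (Q₁ ++ (Q₂ ++ X))
  all-append Q₁ Q₂ X a b = subst (All _) (LP.++-assoc Q₁ Q₂ X) (AllP.++⁺ a b)

  any-appendˡ : ∀ {P : A → Set} Q₁ Q₂ X → Any P (Q₁ ++ Q₂) → Any P (Q₁ ++ (Q₂ ++ X))
  any-appendˡ Q₁ Q₂ X a = subst (Any _) (LP.++-assoc Q₁ Q₂ X) (AnyP.++⁺ˡ a)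

  any-appendʳ : ∀ {P : A → Set} Q₁ Q₂ X → Any P X → Any P (Q₁ ++ (Q₂ ++ X))
  any-appendʳ Q₁ Q₂ X a = AnyP.++⁺ʳ Q₁ (AnyP.++⁺ʳ Q₂ a)

  allPairs-append : ∀ {R : A → A → Set} Q₁ Q₂ X → AllPairs R (Q₁ ++ Q₂) → AllPairs R X →
                    All (λ a → All (R a) X) (Q₁ ++ Q₂) → AllPairs R (Q₁ ++ (Q₂ ++ X))
  allPairs-append Q₁ Q₂ X a b cr = subst (AllPairs _) (LP.++-assoc Q₁ Q₂ X) (AllPairsP.++⁺ a b cr)

  all-any : ∀ {P Q : A → Set} {xs} → All P xs → Any Q xs → ∃ λ x → P x × Q x
  all-any (px ∷ _) (here qx) = _ , px , qx
  all-any (_ ∷ a) (there q) = all-any a q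

module ConcatMapFacts {A B : Set} (f : A → List B) where

  concatMap-all : ∀ {P : B → Set} xs → (∀ e → e ∈ xs → All P (f e)) → All P (concatMap f xs)
  concatMap-all [] h = []
  concatMap-all (x ∷ xs) h = AllP.++⁺ (h x (here refl)) (concatMap-all xs (λ e e∈ → h e (there e∈)))

  concatMap-any : ∀ {P : B → Set} xs {e} → e ∈ xs → Any P (f e) → Any P (concatMap f xs)
  concatMap-any (x ∷ xs) (here refl) a = AnyP.++⁺ˡ a
  concatMap-any (x ∷ xs) (there e∈) a = AnyP.++⁺ʳ (f x) (concatMap-any xs e∈ a)

  concatMap-allPairs : ∀ {R : B → B → Set} xs → Unique xs → (∀ e → AllPairs R (f e)) →
                       (∀ e₁ e₂ → e₁ ≢ e₂ → All (λ a → All (R a) (f e₂)) (f e₁)) → AllPairs R (concatMap f xs)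
  concatMap-allPairs [] u h₁ h₂ = []
  concatMap-allPairs (x ∷ xs) (x∉xs ∷ u) h₁ h₂ =
    AllPairsP.++⁺ (h₁ x) (concatMap-allPairs xs u h₁ h₂)
      (All.tabulate λ a∈ → concatMap-all xs (λ e e∈ → All.lookup (h₂ x e (All.lookup x∉xs e∈)) a∈))

just-injective : ∀ {A : Set} {a b : A} → just a ≡ just b → a ≡ b
just-injective refl = refl

just≢nothing : ∀ {A : Set} {a : A} → just a ≢ nothing
just≢nothing ()

bind-just : ∀ {A B : Set} (mb : Maybe A) (f : A → Maybe B) {b} → (mb >>= f) ≡ just b → ∃ λ a → mb ≡ just a × f a ≡ just b
bind-just (just a) f eq = a , refl , eq
bind-just nothing f ()

module OrderedFieldFacts (ℝ : OrderedReals) where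
  open OrderedReals ℝ
  open IsCommutativeRing isCommutativeRing using (+-assoc; +-comm; +-identityˡ; +-identityʳ; -‿inverseʳ)
  open IsTotalOrder isTotalOrder using (total) renaming (refl to ≤-refl; trans to ≤-trans)

  +-monoʳ : ∀ x y z → x ≤ y → z + x ≤ z + y
  +-monoʳ x y z le = subst₂ _≤_ (+-comm x z) (+-comm y z) (+-mono-≤ x y z le)

  +-mono₂ : ∀ {a b c d} → a ≤ b → c ≤ d → a + c ≤ b + d
  +-mono₂ {a} {b} {c} {d} p q = ≤-trans (+-mono-≤ a b c p) (+-monoʳ c d b q)

  nonneg+ : ∀ {a b} → 0# ≤ a → 0# ≤ b → 0# ≤ a + b
  nonneg+ {a} {b} p q = subst (_≤ a + b) (+-identityˡ 0#) (+-mono₂ p q)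

  ≤-+-nonneg : ∀ {a b} → 0# ≤ a → b ≤ a + b
  ≤-+-nonneg {a} {b} p = subst (_≤ a + b) (+-identityˡ b) (+-mono-≤ 0# a b p)

  -- The telescoping identity behind sidetrack costs:
  -- c(p) + δ(e) = c(pref) + d_T(u) + (c(e) + d_T(w) - d_T(u)).
  +-cancel-middle : ∀ A D E → (A + D) + (E - D) ≡ A + E
  +-cancel-middle A D E = begin
      (A + D) + (E + - D)   ≡⟨ +-assoc A D _ ⟩
      A + (D + (E + - D))   ≡⟨ cong (A +_) (sym (+-assoc D E _)) ⟩
      A + ((D + E) + - D)   ≡⟨ cong (λ z → A + (z + - D)) (+-comm D E) ⟩
      A + ((E + D) + - D)   ≡⟨ cong (A +_) (+-assoc E D _) ⟩
      A + (E + (D + - D))   ≡⟨ cong (λ z → A + (E + z)) (-‿inverseʳ D) ⟩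
      A + (E + 0#)          ≡⟨ cong (A +_) (+-identityʳ E) ⟩
      A + E ∎
    where open ≡-Reasoning

  minimum-split : ∀ {A : Set} (key : A → Carrier) (E₀ : A) Q₀ →
    ∃ λ Q₁ → ∃ λ E → ∃ λ Q₂ → E₀ ∷ Q₀ ≡ Q₁ ++ E ∷ Q₂ × All (λ y → key E ≤ key y) (Q₁ ++ Q₂)
  minimum-split key E₀ [] = [] , E₀ , [] , refl , []
  minimum-split key E₀ (E₁ ∷ Q₀) with minimum-split key E₁ Q₀
  ... | Q₁ , E , Q₂ , eq , mn with total (key E₀) (key E)
  ... | inj₁ le = [] , E₀ , E₁ ∷ Q₀ , refl ,
                  subst (All _) (sym eq) (ListFacts.all-insert Q₁ (All.map (≤-trans le) mn) le)
  ... | inj₂ le = E₀ ∷ Q₁ , E , Q₂ , cong (E₀ ∷_) eq , (le ∷ mn)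

module _ {n : ℕ} {B : Set} where

  _[_≔_] : (Fin n → B) → Fin n → B → Fin n → B
  (f [ u ≔ b ]) z with z ≟ u
  ... | yes _ = b
  ... | no _ = f z

  update-same : ∀ f u b → (f [ u ≔ b ]) u ≡ b
  update-same f u b with u ≟ u
  ... | yes _ = refl
  ... | no ne = ⊥-elim (ne refl)

  update-other : ∀ f u b z → z ≢ u → (f [ u ≔ b ]) z ≡ f z
  update-other f u b z ne with z ≟ u
  ... | yes p = ⊥-elim (ne p)
  ... | no _ = refl

module Graph (ℝ : OrderedReals) (G : WGraph ℝ) where
  open OrderedReals ℝ
  open WGraph G
  open Alg ℝ G
  open OrderedFieldFacts ℝ
  open IsCommutativeRing isCommutativeRing using (+-assoc; +-identityˡ)
  open IsTotalOrder isTotalOrder using () renaming (refl to ≤-refl; trans to ≤-trans)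

  _∈?_ : (x : Node) (xs : List Node) → Dec (x ∈ xs)
  _∈?_ = DecMem._∈?_ _≟_

  simple? : ∀ x q → Dec (Simple x q)
  simple? x q = UniqueDec.unique? (_≟_ {n}) (nodes x q)

  unique-nodes-length : (xs : List Node) → Unique xs → length xs ≤ℕ n
  unique-nodes-length xs u = subst (length xs ≤ℕ_) (LP.length-tabulate (λ i → i))
    (ListFacts.unique⊆⇒length≤ xs (allFin n) u (λ {z} _ → MemP.∈-allFin z))

  cost-++ : ∀ a b → cost (a ++ b) ≡ cost a + cost b
  cost-++ [] b = sym (+-identityˡ _)
  cost-++ (e ∷ a) b = trans (cong (c e +_) (cost-++ a b)) (sym (+-assoc _ _ _))

  IsPath-++ : ∀ {x y z} a b → IsPath x a y → IsPath y b z → IsPath x (a ++ b) z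
  IsPath-++ [] b refl q = q
  IsPath-++ (e ∷ a) b (se , p) q = se , IsPath-++ a b p q

  IsPath-++⁻ : ∀ {x z} a b → IsPath x (a ++ b) z → ∃ λ y → IsPath x a y × IsPath y b z
  IsPath-++⁻ {x} [] b p = x , refl , p
  IsPath-++⁻ (e ∷ a) b (se , p) with IsPath-++⁻ a b p
  ... | y , p₁ , p₂ = y , (se , p₁) , p₂

  IsPath-end : ∀ {x y z} a → IsPath x a y → IsPath x a z → y ≡ z
  IsPath-end [] refl refl = refl
  IsPath-end (e ∷ a) (_ , p) (_ , q) = IsPath-end a p q

  end∈nodes : ∀ {x y} q → IsPath x q y → y ∈ nodes x q
  end∈nodes [] refl = here refl
  end∈nodes (e ∷ q) (_ , p) = there (end∈nodes q p)

  nodes-++ : ∀ x a b → nodes x (a ++ b) ≡ nodes x a ++ map tgt b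
  nodes-++ x a b = cong (x ∷_) (LP.map-++ tgt a b)

  nodes-split : ∀ x a e r → nodes x (a ++ e ∷ r) ≡ nodes x a ++ nodes (tgt e) r
  nodes-split x a e r = nodes-++ x a (e ∷ r)

  nodes-suffix : ∀ v a e r {z} → z ∈ nodes (tgt e) r → z ∈ nodes v (a ++ e ∷ r)
  nodes-suffix v a e r {z} z∈ = there (subst (z ∈_) (sym (LP.map-++ tgt a (e ∷ r))) (MemP.∈-++⁺ʳ (map tgt a) z∈))

  simple-prefix : ∀ {x} P a b → Simple x (P ++ (a ++ b)) → Simple x (P ++ a)
  simple-prefix {x} P a b u = ListFacts.unique-++ˡ (nodes x (P ++ a))
    (subst Unique (nodes-++ x (P ++ a) b) (subst (Simple x) (sym (LP.++-assoc P a b)) u))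

  follow-refl : ∀ f T x → follow f T x x ≡ just []
  follow-refl f T x with x ≟ x
  ... | yes _ = refl
  ... | no ne = ⊥-elim (ne refl)

  follow-step : ∀ {f T x y e q} → x ≢ y → T x ≡ just e → follow f T (tgt e) y ≡ just q →
                follow (suc f) T x y ≡ just (e ∷ q)
  follow-step {f} {T} {x} {y} ne tx fq with x ≟ y
  ... | yes p = ⊥-elim (ne p)
  ... | no _ rewrite tx | fq = refl

  follow-[] : ∀ {f T x y} → follow f T x y ≡ just [] → x ≡ y
  follow-[] {f} {T} {x} {y} eq with x ≟ y
  ... | yes p = p
  follow-[] {zero} () | no _
  follow-[] {suc f} {T} {x} {y} eq | no _ with T x
  follow-[] {suc f} {T} {x} {y} () | no _ | nothing
  ... | just e with follow f T (tgt e) y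
  follow-[] {suc f} {T} {x} {y} () | no _ | just e | nothing
  follow-[] {suc f} {T} {x} {y} () | no _ | just e | just q

  follow-∷ : ∀ {f T x y e q} → follow f T x y ≡ just (e ∷ q) →
             ∃ λ f' → f ≡ suc f' × x ≢ y × T x ≡ just e × follow f' T (tgt e) y ≡ just q
  follow-∷ {f} {T} {x} {y} eq with x ≟ y
  follow-∷ {f} {T} {x} {y} () | yes _
  follow-∷ {zero} {T} {x} {y} () | no _
  follow-∷ {suc f} {T} {x} {y} eq | no ne with T x in tx
  follow-∷ {suc f} {T} {x} {y} () | no ne | nothing
  ... | just e' with follow f T (tgt e') y in fq
  follow-∷ {suc f} {T} {x} {y} () | no ne | just e' | nothing
  follow-∷ {suc f} {T} {x} {y} refl | no ne | just e' | just q' = f , refl , ne , refl , fq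

  follow-mono : ∀ {f f' T x y q} → f ≤ℕ f' → follow f T x y ≡ just q → follow f' T x y ≡ just q
  follow-mono {f} {f'} {T} {x} {y} {[]} le eq with follow-[] {f} {T} {x} {y} eq
  ... | refl = follow-refl f' T x
  follow-mono {f} {f'} {T} {x} {y} {e ∷ q} le eq with follow-∷ {f} {T} {x} {y} eq
  follow-mono {.(suc g)} {suc f'} {T} {x} {y} {e ∷ q} (N.s≤s le) eq | g , refl , ne , tx , fq =
    follow-step ne tx (follow-mono {x = tgt e} {y = y} le fq)

  follow-det : ∀ {f f' T x y q q'} → follow f T x y ≡ just q → follow f' T x y ≡ just q' → q ≡ q'
  follow-det {f} {f'} {T} {x} {y} {[]} {[]} e₁ e₂ = refl
  follow-det {f} {f'} {T} {x} {y} {[]} {e ∷ q'} e₁ e₂ with follow-[] {f} {T} {x} {y} e₁ | follow-∷ {f'} {T} {x} {y} e₂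
  ... | p | _ , _ , ne , _ = ⊥-elim (ne p)
  follow-det {f} {f'} {T} {x} {y} {e ∷ q} {[]} e₁ e₂ with follow-[] {f'} {T} {x} {y} e₂ | follow-∷ {f} {T} {x} {y} e₁
  ... | p | _ , _ , ne , _ = ⊥-elim (ne p)
  follow-det {f} {f'} {T} {x} {y} {e ∷ q} {e' ∷ q'} e₁ e₂ with follow-∷ {f} {T} {x} {y} e₁ | follow-∷ {f'} {T} {x} {y} e₂
  ... | _ , _ , _ , t₁ , r₁ | _ , _ , _ , t₂ , r₂ with trans (sym t₁) t₂
  ... | refl = cong (e ∷_) (follow-det {x = tgt e} {y = y} r₁ r₂)

  follow-split : ∀ {f T x y q u} → follow f T x y ≡ just q → u ∈ nodes x q →
    ∃₂ λ a b → q ≡ a ++ b × follow f T x u ≡ just a × follow f T u y ≡ just b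
  follow-split {f} {T} {x} {y} {q} {u} eq mem = split (x ≟ u) q eq mem
    where
    split : Dec (x ≡ u) → ∀ q → follow f T x y ≡ just q → u ∈ nodes x q →
            ∃₂ λ a b → q ≡ a ++ b × follow f T x u ≡ just a × follow f T u y ≡ just b
    split (yes refl) q eq mem = [] , q , refl , follow-refl f T x , eq
    split (no ne) q eq (here p) = ⊥-elim (ne (sym p))
    split (no ne) (e ∷ q) eq (there mem) with follow-∷ {f} {T} {x} {y} eq
    ... | g , refl , nxy , tx , fq with follow-split {x = tgt e} {y = y} fq mem
    ... | a , b , refl , fa , fb =
      e ∷ a , b , refl , follow-step ne tx fa , follow-mono {x = u} {y = y} (NP.n≤1+n g) fb

  -- Tree walks never revisit a node: a revisit would make the walk from
  -- the repeated node a proper suffix of itself.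
  follow-simple : ∀ {f T x y} q → follow f T x y ≡ just q → Simple x q
  follow-simple [] eq = [] ∷ []
  follow-simple {f} {T} {x} {y} (e ∷ q) eq with follow-∷ {f} {T} {x} {y} eq
  ... | g , refl , nxy , tx , fq =
    All.tabulate x∉rest ∷ follow-simple {x = tgt e} {y = y} q fq
    where
    x∉rest : ∀ {z} → z ∈ nodes (tgt e) q → x ≢ z
    x∉rest z∈ refl with follow-split {x = tgt e} {y = y} fq z∈
    ... | a , b , refl , fa , fb with follow-det {x = x} {y = y} eq (follow-mono {x = x} {y = y} (NP.n≤1+n g) fb)
    ... | beq = ListFacts.¬proper-suffix a e (a ++ b) (cong (a ++_) (sym beq))

  follow-agree : ∀ {f T T' x y} q → follow f T x y ≡ just q →
                 (∀ {w} → w ∈ nodes x q → T w ≡ T' w) → follow f T' x y ≡ just q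
  follow-agree {f} {T} {T'} {x} {y} [] eq ag with follow-[] {f} {T} {x} {y} eq
  ... | refl = follow-refl f T' x
  follow-agree {f} {T} {T'} {x} {y} (e ∷ q) eq ag with follow-∷ {f} {T} {x} {y} eq
  ... | g , refl , ne , tx , fq =
    follow-step ne (trans (sym (ag (here refl))) tx) (follow-agree {x = tgt e} {y = y} q fq (λ w∈ → ag (there w∈)))


  module SPTreeFacts (s t : Node) (k : ℕ) where

    -- The tree edge of x leaves x: x has a path to t (otherwise T x would
    -- be empty), and T x is the first edge of x's tree path.
    tree-edge-src : ∀ {U T} → SPTree s t k U T → ∀ x e → T x ≡ just e → src e ≡ x
    tree-edge-src {U} {T} (Tt , reach , unreach) x e tx with src e ≟ x
    ... | yes p = p
    ... | no ne = ⊥-elim (¬¬reachable (λ ex → ne (first-edge ex)))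
      where
      ¬¬reachable : ¬ ¬ (∃ λ q → PathIn U x q t)
      ¬¬reachable np = just≢nothing (trans (sym tx) (unreach x np))
      first-edge : (∃ λ q → PathIn U x q t) → src e ≡ x
      first-edge ex with reach x ex
      ... | [] , tp , (refl , _) , _ = ⊥-elim (just≢nothing (trans (sym tx) Tt))
      ... | (e' ∷ q) , tp , ((se' , _) , _) , _ with follow-∷ {n} {T} {x} {t} tp
      ...   | _ , _ , _ , tx' , _ with trans (sym tx) tx'
      ...     | refl = se'

    follow-path : ∀ {U T f x y} → SPTree s t k U T → ∀ q → follow f T x y ≡ just q → IsPath x q y
    follow-path {U} {T} {f} {x} {y} sp [] eq = follow-[] {f} {T} {x} {y} eq
    follow-path {U} {T} {f} {x} {y} sp (e ∷ q) eq with follow-∷ {f} {T} {x} {y} eq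
    ... | g , refl , _ , tx , fq = tree-edge-src sp x e tx , follow-path {f = g} {x = tgt e} {y = y} sp q fq

    -- The tree path of a node outside U stays outside U (it is the path
    -- promised by the SP-tree property of G - U).
    treePath-avoid : ∀ {U T v q} → SPTree s t k U T → treePath s t k T v ≡ just q → v ∉ U → All (_∉ U) (nodes v q)
    treePath-avoid {U} {T} {v} {[]} sp tp vU = vU ∷ []
    treePath-avoid {U} {T} {v} {e ∷ q} (Tt , reach , unreach) tp vU with follow-∷ {n} {T} {v} {t} tp
    ... | _ , _ , _ , tx , _ = All.tabulate λ x∈ x∈U → ¬¬reachable (λ ex → avoid ex x∈ x∈U)
      where
      ¬¬reachable : ¬ ¬ (∃ λ q → PathIn U v q t)
      ¬¬reachable np = just≢nothing (trans (sym tx) (unreach v np))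
      avoid : (∃ λ q → PathIn U v q t) → ∀ {x} → x ∈ nodes v (e ∷ q) → x ∉ U
      avoid ex x∈ with reach v ex
      ... | q' , tp' , (_ , q'∉U) , _ with follow-det {x = v} {y = t} tp tp'
      ... | refl = All.lookup q'∉U x∈

  -- The set S of settled nodes grows by one node per round; each settled
  -- node has a tree path inside S whose cost D x is minimal among all x-t
  -- paths of G - U.  A round settles the tail of a crossing edge (into S)
  -- minimising c e + D(tgt e); when no crossing edge is left, every node
  -- that can reach t in G - U is settled.
  module Dijkstra (c≥0 : ∀ e → 0# ≤ c e) (s t : Node) (k : ℕ) (U : List Node) where

    cost≥0 : ∀ q → 0# ≤ cost q
    cost≥0 [] = ≤-refl
    cost≥0 (e ∷ q) = nonneg+ (c≥0 e) (cost≥0 q)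

    record Settled (S : List Node) (T : Tree) (D : Node → Carrier) : Set where
      field
        S-unique : Unique S
        t∈S : t ∈ S
        T-root : T t ≡ nothing
        T-outside : ∀ x → x ∉ S → T x ≡ nothing
        settled : ∀ x → x ∈ S → x ∉ U ×
          (∃ λ q → follow (length S) T x t ≡ just q × PathIn U x q t × All (_∈ S) (nodes x q) × cost q ≡ D x) ×
          (∀ q' → PathIn U x q' t → D x ≤ cost q')

    Crossing : List Node → Edge → Set
    Crossing S e = src e ∉ S × src e ∉ U × tgt e ∈ S

    crossing? : ∀ S e → Dec (Crossing S e)
    crossing? S e = ¬? (src e ∈? S) ×-dec (¬? (src e ∈? U) ×-dec (tgt e ∈? S))

    crossings : List Node → List Edge
    crossings S = filter (crossing? S) (allFin m)

    ∈-crossings : ∀ {S e} → Crossing S e → e ∈ crossings S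
    ∈-crossings {S} {e} cr = MemP.∈-filter⁺ (crossing? S) (MemP.∈-allFin e) cr

    path-crosses : ∀ S x q → IsPath x q t → x ∉ S → t ∈ S → All (_∉ U) (nodes x q) →
      ∃ λ a → ∃ λ e' → ∃ λ b → q ≡ a ++ e' ∷ b × Crossing S e' × IsPath (tgt e') b t × All (_∉ U) (nodes (tgt e') b)
    path-crosses S x [] refl x∉ t∈ _ = ⊥-elim (x∉ t∈)
    path-crosses S x (e ∷ q) (se , p) x∉ t∈ (xU ∷ au) with tgt e ∈? S
    ... | yes te = [] , e , q , refl , (subst (_∉ S) (sym se) x∉ , subst (_∉ U) (sym se) xU , te) , p , au
    ... | no te with path-crosses S (tgt e) q p te t∈ au
    ... | a , e' , b , refl , cd , pb , ab = e ∷ a , e' , b , refl , cd , pb , ab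

    via : (Node → Carrier) → Edge → Carrier
    via D e = c e + D (tgt e)

    best-crossing : ∀ S D e₀ es → crossings S ≡ e₀ ∷ es →
      ∃ λ e → Crossing S e × (∀ {e'} → e' ∈ crossings S → via D e ≤ via D e')
    best-crossing S D e₀ es eq with minimum-split (via D) e₀ es
    ... | Q₁ , e , Q₂ , split , mn =
      e , proj₂ (MemP.∈-filter⁻ (crossing? S) {xs = allFin m} e∈) , minimal
      where
      e∈ : e ∈ crossings S
      e∈ = subst (e ∈_) (sym eq) (subst (e ∈_) (sym split) (MemP.∈-++⁺ʳ Q₁ (here refl)))
      minimal : ∀ {e'} → e' ∈ crossings S → via D e ≤ via D e'
      minimal {e'} e'∈ with ListFacts.any-remove Q₁ (subst (e' ∈_) split (subst (e' ∈_) eq e'∈))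
      ... | inj₁ refl = ≤-refl
      ... | inj₂ m' = All.lookup mn m'

    -- Any u-t path leaves S \ {u}'s complement
    -- through some crossing edge e', so it costs at least via D e' ≥ via D e.
    settle : ∀ {S T D} → Settled S T D → ∀ e → Crossing S e → (∀ {e'} → e' ∈ crossings S → via D e ≤ via D e') →
             Settled (src e ∷ S) (T [ src e ≔ just e ]) (D [ src e ≔ via D e ])
    settle {S} {T} {D} inv e (u∉S , u∉U , w∈S) emin = record
      { S-unique = All.tabulate (λ z∈ u≡z → u∉S (subst (_∈ S) (sym u≡z) z∈)) ∷ S-unique
      ; t∈S = there t∈S
      ; T-root = trans (update-other T u (just e) t t≢u) T-root
      ; T-outside = λ x x∉ → trans (update-other T u (just e) x (λ x≡u → x∉ (here x≡u))) (T-outside x (λ x∈ → x∉ (there x∈)))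
      ; settled = settled'
      }
      where
      open Settled inv
      u : Node
      u = src e
      T' : Tree
      T' = T [ u ≔ just e ]
      D' : Node → Carrier
      D' = D [ u ≔ via D e ]
      t≢u : t ≢ u
      t≢u t≡u = u∉S (subst (_∈ S) t≡u t∈S)
      agree-on-S : ∀ {w} → w ∈ S → T w ≡ T' w
      agree-on-S {w} w∈ = sym (update-other T u (just e) w (λ w≡u → u∉S (subst (_∈ S) w≡u w∈)))
      settled' : ∀ x → x ∈ u ∷ S → x ∉ U ×
        (∃ λ q → follow (length (u ∷ S)) T' x t ≡ just q × PathIn U x q t × All (_∈ u ∷ S) (nodes x q) × cost q ≡ D' x) ×
        (∀ q' → PathIn U x q' t → D' x ≤ cost q')
      settled' x (here refl) with settled (tgt e) w∈S
      ... | _ , (qw , fw , (pw , aw) , allS , cw) , _ =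
        u∉U ,
        (e ∷ qw , follow-step (λ u≡t → t≢u (sym u≡t)) (update-same T u (just e))
                     (follow-agree {x = tgt e} {y = t} qw fw (λ w∈ → agree-on-S (All.lookup allS w∈))) ,
         ((refl , pw) , (u∉U ∷ aw)) , (here refl ∷ All.map there allS) ,
         trans (cong (c e +_) cw) (sym (update-same D u (via D e)))) ,
        optimal
        where
        optimal : ∀ q' → PathIn U u q' t → D' u ≤ cost q'
        optimal q' (p , au) with path-crosses S u q' p u∉S t∈S au
        ... | a , e' , b , refl , cd , pb , ab =
          subst (_≤ cost (a ++ e' ∷ b)) (sym (update-same D u (via D e)))
            (≤-trans (emin (∈-crossings cd))
            (≤-trans (+-monoʳ _ _ (c e') (proj₂ (proj₂ (settled (tgt e') (proj₂ (proj₂ cd)))) b (pb , ab)))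
            (subst (c e' + cost b ≤_) (sym (cost-++ a (e' ∷ b))) (≤-+-nonneg (cost≥0 a)))))
      settled' x (there x∈) with settled x x∈
      ... | xU , (q , fq , pin , allS , cq) , opt =
        xU ,
        (q , follow-mono {x = x} {y = t} (NP.n≤1+n (length S))
               (follow-agree {x = x} {y = t} q fq (λ w∈ → agree-on-S (All.lookup allS w∈))) ,
         pin , All.map there allS , trans cq (sym (update-other D u (via D e) x x≢u))) ,
        (λ q' pq' → subst (_≤ cost q') (sym (update-other D u (via D e) x x≢u)) (opt q' pq'))
        where
        x≢u : x ≢ u
        x≢u x≡u = u∉S (subst (_∈ S) x≡u x∈)

    finish : ∀ {S T D} → Settled S T D → crossings S ≡ [] → SPTree s t k U T
    finish {S} {T} {D} inv no-crossing = T-root , reach , unreach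
      where
      open Settled inv
      reach : ∀ v → (∃ λ q → PathIn U v q t) →
              ∃ λ q → treePath s t k T v ≡ just q × PathIn U v q t × (∀ q' → PathIn U v q' t → cost q ≤ cost q')
      reach v (q' , p , au) with v ∈? S
      ... | yes v∈ with settled v v∈
      ...   | _ , (q , fq , pin , _ , cq) , opt =
              q , follow-mono {x = v} {y = t} (unique-nodes-length S S-unique) fq , pin ,
              λ q'' pq'' → subst (_≤ cost q'') (sym cq) (opt q'' pq'')
      reach v (q' , p , au) | no v∉ with path-crosses S v q' p v∉ t∈S au
      ... | a , e' , b , _ , cd , _ , _ with subst (e' ∈_) no-crossing (∈-crossings cd)
      ... | ()
      unreach : ∀ v → ¬ (∃ λ q → PathIn U v q t) → T v ≡ nothing
      unreach v np with v ∈? S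
      ... | yes v∈ with settled v v∈
      ...   | _ , (q , _ , pin , _) , _ = ⊥-elim (np (q , pin))
      unreach v np | no v∉ = T-outside v v∉

    -- The rounds; fuel bounds the number of nodes still to be settled.
    rounds : ∀ fuel S T D → Settled S T D → n ≤ℕ length S N.+ fuel → ∃ λ T' → SPTree s t k U T'
    rounds fuel S T D inv le with crossings S in eq
    ... | [] = T , finish inv eq
    ... | e₀ ∷ es with best-crossing S D e₀ es eq
    ... | e , cr , emin with fuel
    ...   | suc fuel' = rounds fuel' (src e ∷ S) _ _ (settle inv e cr emin) (subst (n ≤ℕ_) (NP.+-suc (length S) fuel') le)
    ...   | zero = ⊥-elim (NP.n≮n (length S) (NP.≤-trans too-many (subst (n ≤ℕ_) (NP.+-identityʳ (length S)) le)))
      where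
      too-many : suc (length S) ≤ℕ n
      too-many = unique-nodes-length (src e ∷ S) (Settled.S-unique (settle inv e cr emin))

    spTree-exists : ∃ λ T → SPTree s t k U T
    spTree-exists with t ∈? U
    ... | yes t∈U = (λ _ → nothing) , refl , (λ v (q , p , au) → ⊥-elim (All.lookup au (end∈nodes q p) t∈U)) , (λ _ _ → refl)
    ... | no t∉U = rounds n (t ∷ []) (λ _ → nothing) (λ _ → 0#) initial (NP.n≤1+n n)
      where
      initial : Settled (t ∷ []) (λ _ → nothing) (λ _ → 0#)
      initial = record
        { S-unique = [] ∷ []
        ; t∈S = here refl
        ; T-root = refl
        ; T-outside = λ _ _ → refl
        ; settled = λ { x (here refl) → t∉U ,
                          ([] , follow-refl 1 (λ _ → nothing) t , (refl , (t∉U ∷ [])) , (here refl ∷ []) , refl) ,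
                          (λ q' _ → cost≥0 q') }
        }

  module SequenceFacts (s t : Node) (k : ℕ) where

    upTo-snoc : ∀ T x ini e Te y pr r → upTo s t k T x ini (src e) ≡ just pr → follow n Te (tgt e) y ≡ just r →
                upTo s t k T x (ini ++ [ (e , Te) ]) y ≡ just (pr ++ e ∷ r)
    upTo-snoc T x [] e Te y pr r eq1 eq2 rewrite eq1 | eq2 = refl
    upTo-snoc T x ((e1 , T1) ∷ ini) e Te y pr r eq1 eq2 with bind-just (follow n T x (src e1)) _ eq1
    ... | q1 , f1 , eq1' with bind-just (upTo s t k T1 (tgt e1) ini (src e)) _ eq1'
    ... | r1 , u1 , refl rewrite f1 | upTo-snoc T1 (tgt e1) ini e Te y r1 r u1 eq2 =
      cong just (sym (LP.++-assoc q1 (e1 ∷ r1) (e ∷ r)))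

    lastInfo-snoc : ∀ T x ini e Te → lastInfo s t k T x (ini ++ [ (e , Te) ]) ≡ (Te , tgt e)
    lastInfo-snoc T x [] e Te = refl
    lastInfo-snoc T x ((e1 , T1) ∷ ini) e Te = lastInfo-snoc T1 (tgt e1) ini e Te

    -- The walk up to and including the last sidetrack of a sequence;
    -- for the initial tree T0 and start s this is pref(p) followed by the
    -- deviation edge.
    prefixAlong : Tree → Node → Seq s t k → Maybe (List Edge)
    prefixAlong T x [] = just []
    prefixAlong T x ((e , Te) ∷ rest) = follow n T x (src e) >>= λ q → prefixAlong Te (tgt e) rest >>= λ r → just (q ++ e ∷ r)

    prefixAlong-snoc : ∀ T x ini e Te pr → upTo s t k T x ini (src e) ≡ just pr → prefixAlong T x (ini ++ [ (e , Te) ]) ≡ just (pr ++ [ e ])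
    prefixAlong-snoc T x [] e Te pr eq1 rewrite eq1 = refl
    prefixAlong-snoc T x ((e1 , T1) ∷ ini) e Te pr eq1 with bind-just (follow n T x (src e1)) _ eq1
    ... | q1 , f1 , eq1' with bind-just (upTo s t k T1 (tgt e1) ini (src e)) _ eq1'
    ... | r1 , u1 , refl rewrite f1 | prefixAlong-snoc T1 (tgt e1) ini e Te r1 u1 =
      cong just (sym (LP.++-assoc q1 (e1 ∷ r1) [ e ]))

  module Correctness (s t : Node) (k : ℕ) (T0 : Tree) (spt0 : SPTree s t k [] T0)
                     (p0 : List Edge) (p0eq : treePath s t k T0 s ≡ just p0) where
    open SPTreeFacts s t k
    open SequenceFacts s t k
    open ListFacts
    open ConcatMapFacts

    Sequence : Set
    Sequence = Seq s t k

    QEntry : Set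
    QEntry = Entry s t k

    devPrefix : Sequence → Maybe (List Edge)
    devPrefix = prefixAlong T0 s

    -- A queue entry is well formed when it represents the walk P ++ sf
    -- with key c(P ++ sf), where P = devPrefix (a path from s to v), T is
    -- the entry's last tree, an SP tree of G - U, and sf the T-path from v
    -- to t.  The nodes of U cannot occur after P on any simple extension of
    -- P (they lie on pref(p)).
    record WellFormed (E : QEntry) : Set where
      field
        T : Tree
        v : Node
        U : List Node
        P : List Edge
        sf : List Edge
        last≡ : lastInfo s t k T0 s (proj₁ E) ≡ (T , v)
        prefix≡ : devPrefix (proj₁ E) ≡ just P
        extends : ∀ y r → follow n T v y ≡ just r → upTo s t k T0 s (proj₁ E) y ≡ just (P ++ r)
        suffix≡ : follow n T v t ≡ just sf
        key≡ : proj₂ E ≡ cost (P ++ sf)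
        prefix-path : IsPath s P v
        sp-tree : SPTree s t k U T
        blocked : ∀ x → x ∈ U → ∀ rest → Simple s (P ++ rest) → x ∉ nodes v rest
        shape : (proj₁ E ≡ [] × P ≡ []) ⊎
                (∃ λ ini → ∃ λ e → ∃ λ Te → ∃ λ pr → proj₁ E ≡ ini ++ [ (e , Te) ] ×
                   upTo s t k T0 s ini (src e) ≡ just pr × Simple s pr)

    rep≡ : ∀ {E} (W : WellFormed E) → rep s t k T0 (proj₁ E) ≡ just (WellFormed.P W ++ WellFormed.sf W)
    rep≡ W = WellFormed.extends W t (WellFormed.sf W) (WellFormed.suffix≡ W)

    root : QEntry
    root = ([] , cost p0)

    root-wellFormed : WellFormed root
    root-wellFormed = record
      { T = T0 ; v = s ; U = [] ; P = [] ; sf = p0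
      ; last≡ = refl ; prefix≡ = refl ; extends = λ y r fr → fr ; suffix≡ = p0eq ; key≡ = refl ; prefix-path = refl
      ; sp-tree = spt0 ; blocked = λ x () ; shape = inj₁ (refl , refl) }

    -- The entry pushed in step (i) for the sidetrack e of the entry sq with
    -- c(p) = cp; dw, du are d_T at the head and tail of e.

    child : Sequence → Carrier → Tree → Edge → Carrier → Carrier → QEntry
    child sq cp T e dw du = (sq ++ [ (e , T) ] , cp + (c e + dw - du))

    record Pushed (T : Tree) (sfn : List Node) (e : Edge) (dw du : Carrier) : Set where
      constructor pushed
      field
        sidetrack : T (src e) ≢ just e
        on-suffix : src e ∈ sfn
        not-target : src e ≢ t
        head-dist : dT s t k T (tgt e) ≡ just dw
        tail-dist : dT s t k T (src e) ≡ just du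

    data NotPushed (T : Tree) (sfn : List Node) (e : Edge) : Set where
      tree-edge : T (src e) ≡ just e → NotPushed T sfn e
      off-suffix : src e ∉ sfn → NotPushed T sfn e
      at-target : src e ≡ t → NotPushed T sfn e
      head-unreachable : dT s t k T (tgt e) ≡ nothing → NotPushed T sfn e
      tail-unreachable : dT s t k T (src e) ≡ nothing → NotPushed T sfn e

    pushOne-cases : ∀ sq cp T sfn e → (NotPushed T sfn e × pushOne s t k sq cp T sfn e ≡ []) ⊎
      (∃₂ λ dw du → Pushed T sfn e dw du × pushOne s t k sq cp T sfn e ≡ [ child sq cp T e dw du ])
    pushOne-cases sq cp T sfn e with MaybeP.≡-dec _≟_ (T (src e)) (just e)
    ... | yes p = inj₁ (tree-edge p , refl)
    ... | no n1 with DecMem._∈?_ _≟_ (src e) sfn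
    ...   | no p = inj₁ (off-suffix p , refl)
    ...   | yes n2 with src e ≟ t
    ...     | yes p = inj₁ (at-target p , refl)
    ...     | no n3 with dT s t k T (tgt e) in eq1 | dT s t k T (src e) in eq2
    ...       | just dw | just du = inj₂ (dw , du , pushed n1 n2 n3 eq1 eq2 , refl)
    ...       | just _ | nothing = inj₁ (tail-unreachable eq2 , refl)
    ...       | nothing | _ = inj₁ (head-unreachable eq1 , refl)

    pushOne-in : ∀ sq cp T sfn e dw du → Pushed T sfn e dw du →
                 pushOne s t k sq cp T sfn e ≡ [ child sq cp T e dw du ]
    pushOne-in sq cp T sfn e dw du (pushed n1 n2 n3 eq1 eq2) with pushOne-cases sq cp T sfn e
    ... | inj₂ (dw' , du' , pushed _ _ _ eq1' eq2' , eq) with trans (sym eq1) eq1' | trans (sym eq2) eq2'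
    ...   | refl | refl = eq
    pushOne-in sq cp T sfn e dw du (pushed n1 n2 n3 eq1 eq2) | inj₁ (tree-edge p , _) = ⊥-elim (n1 p)
    pushOne-in sq cp T sfn e dw du (pushed n1 n2 n3 eq1 eq2) | inj₁ (off-suffix p , _) = ⊥-elim (p n2)
    pushOne-in sq cp T sfn e dw du (pushed n1 n2 n3 eq1 eq2) | inj₁ (at-target p , _) = ⊥-elim (n3 p)
    pushOne-in sq cp T sfn e dw du (pushed n1 n2 n3 eq1 eq2) | inj₁ (head-unreachable p , _) = ⊥-elim (just≢nothing (trans (sym eq1) p))
    pushOne-in sq cp T sfn e dw du (pushed n1 n2 n3 eq1 eq2) | inj₁ (tail-unreachable p , _) = ⊥-elim (just≢nothing (trans (sym eq2) p))

    -- A child of a simple well-formed entry is well formed, with prefix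
    -- P ++ a ++ [e] for the part a of sf up to src e and suffix the T-path
    -- of tgt e; its key telescopes to the length of the represented path.
    child-wellFormed : ∀ {E} (W : WellFormed E) → Simple s (WellFormed.P W ++ WellFormed.sf W) → ∀ e dw du a b →
               Pushed (WellFormed.T W) (nodes (WellFormed.v W) (WellFormed.sf W)) e dw du →
               WellFormed.sf W ≡ a ++ b → follow n (WellFormed.T W) (WellFormed.v W) (src e) ≡ just a →
               follow n (WellFormed.T W) (src e) t ≡ just b → ∀ q' → treePath s t k (WellFormed.T W) (tgt e) ≡ just q' →
               WellFormed (child (proj₁ E) (cost (WellFormed.P W ++ WellFormed.sf W)) (WellFormed.T W) e dw du)
    child-wellFormed {sq , key} W simp e dw du a b (pushed n1 n2 n3 eq1 eq2) sfeq fa fb q' tq' = record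
      { T = T ; v = tgt e ; U = U ; P = (P ++ a) ++ [ e ] ; sf = q'
      ; last≡ = lastInfo-snoc T0 s sq e T
      ; prefix≡ = prefixAlong-snoc T0 s sq e T (P ++ a) (extends (src e) a fa)
      ; extends = λ y r fr → trans (upTo-snoc T0 s sq e T y (P ++ a) r (extends (src e) a fa) fr)
                              (cong just (sym (LP.++-assoc (P ++ a) [ e ] r)))
      ; suffix≡ = tq'
      ; key≡ = keyeq
      ; prefix-path = IsPath-++ (P ++ a) [ e ] (IsPath-++ P a prefix-path (follow-path sp-tree a fa)) (refl , refl)
      ; sp-tree = sp-tree
      ; blocked = λ x x∈ rest' simp' z∈ →
          blocked x x∈ (a ++ e ∷ rest') (subst (Simple s) (reassoc rest') simp') (nodes-suffix v a e rest' z∈)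
      ; shape = inj₂ (sq , e , T , P ++ a , refl , extends (src e) a fa ,
                      simple-prefix P a b (subst (λ z → Simple s (P ++ z)) sfeq simp))
      }
      where
      open WellFormed W
      reassoc : ∀ r → ((P ++ a) ++ [ e ]) ++ r ≡ P ++ (a ++ e ∷ r)
      reassoc r = trans (LP.++-assoc (P ++ a) [ e ] r) (LP.++-assoc P a (e ∷ r))
      dw≡ : dw ≡ cost q'
      dw≡ with trans (sym eq1) (cong (λ z → z >>= λ q → just (cost q)) tq')
      ... | refl = refl
      du≡ : du ≡ cost b
      du≡ with trans (sym eq2) (cong (λ z → z >>= λ q → just (cost q)) fb)
      ... | refl = refl
      keyeq : cost (P ++ sf) + (c e + dw - du) ≡ cost (((P ++ a) ++ [ e ]) ++ q')
      keyeq = begin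
          cost (P ++ sf) + (c e + dw - du)
            ≡⟨ cong (λ z → cost (P ++ sf) + (c e + z - du)) dw≡ ⟩
          cost (P ++ sf) + (c e + cost q' - du)
            ≡⟨ cong (λ z → cost (P ++ z) + (c e + cost q' - du)) sfeq ⟩
          cost (P ++ (a ++ b)) + (c e + cost q' - du)
            ≡⟨ cong (λ z → cost z + (c e + cost q' - du)) (sym (LP.++-assoc P a b)) ⟩
          cost ((P ++ a) ++ b) + (c e + cost q' - du)
            ≡⟨ cong (λ z → z + (c e + cost q' - du)) (cost-++ (P ++ a) b) ⟩
          (cost (P ++ a) + cost b) + (c e + cost q' - du)
            ≡⟨ cong (λ z → (cost (P ++ a) + z) + (c e + cost q' - du)) (sym du≡) ⟩
          (cost (P ++ a) + du) + (c e + cost q' - du)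
            ≡⟨ +-cancel-middle (cost (P ++ a)) du (c e + cost q') ⟩
          cost (P ++ a) + (c e + cost q')
            ≡⟨ sym (cost-++ (P ++ a) (e ∷ q')) ⟩
          cost ((P ++ a) ++ e ∷ q')
            ≡⟨ cong cost (sym (LP.++-assoc (P ++ a) [ e ] q')) ⟩
          cost (((P ++ a) ++ [ e ]) ++ q') ∎
        where open ≡-Reasoning

    Incomp : List Edge → List Edge → Set
    Incomp P1 P2 = ∀ r1 r2 → P1 ++ r1 ≢ P2 ++ r2

    -- The deviation prefixes of two entries are incomparable, so the
    -- path sets they cover are disjoint.
    IncomparablePrefixes : QEntry → QEntry → Set
    IncomparablePrefixes E1 E2 = ∀ {P1 P2} → devPrefix (proj₁ E1) ≡ just P1 → devPrefix (proj₁ E2) ≡ just P2 → Incomp P1 P2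

    incomparable-sym : ∀ {E1 E2} → IncomparablePrefixes E1 E2 → IncomparablePrefixes E2 E1
    incomparable-sym d d2 d1 r2 r1 eq = d d1 d2 r1 r2 (sym eq)

    FreshPrefix : List (List Edge) → QEntry → Set
    FreshPrefix out E = ∀ {P} → devPrefix (proj₁ E) ≡ just P → ∀ o → o ∈ out → ∀ rest → o ≢ P ++ rest

    Covers : List Edge → QEntry → Set
    Covers p' E = Σ (WellFormed E) λ W → (∃ λ rest → p' ≡ WellFormed.P W ++ rest) × proj₂ E ≤ cost p'

    SimplePath : List Edge → Set
    SimplePath p = IsPath s p t × Simple s p

    record Invariant (Q : List QEntry) (out : List (List Edge)) : Set where
      field
        outLen : length out ≤ℕ k
        outU : Unique out
        outP : All SimplePath out
        outOptimal : ∀ p p' → p ∈ out → IsPath s p' t → Simple s p' → p' ∉ out → cost p ≤ cost p'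
        wellFormed : All WellFormed Q
        fresh : All (FreshPrefix out) Q
        incomparable : AllPairs IncomparablePrefixes Q
        cover : ∀ p' → IsPath s p' t → Simple s p' → p' ∉ out → Any (Covers p') Q

    devPrefix-unique : ∀ {E} (W : WellFormed E) {P'} → devPrefix (proj₁ E) ≡ just P' → P' ≡ WellFormed.P W
    devPrefix-unique W d = just-injective (trans (sym d) (WellFormed.prefix≡ W))

    -- Initially the root covers every s-t path, as p0 is a shortest one.
    invariant₀ : Invariant [ root ] []
    invariant₀ = record
      { outLen = N.z≤n
      ; outU = []
      ; outP = []
      ; outOptimal = λ _ _ ()
      ; wellFormed = root-wellFormed ∷ []
      ; fresh = (λ _ _ ()) ∷ []
      ; incomparable = [] ∷ []
      ; cover = λ p' ip sp _ → here (root-wellFormed , (p' , refl) , opt p' ip)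
      }
      where
      opt : ∀ p' → IsPath s p' t → cost p0 ≤ cost p'
      opt p' ip with proj₁ (proj₂ spt0) s (p' , ip , All.tabulate (λ _ ()))
      ... | q , tq , _ , le with just-injective (trans (sym p0eq) tq)
      ... | refl = le p' (ip , All.tabulate (λ _ ()))

    pushOne-all : ∀ {P : QEntry → Set} sq cp T sfn e → (∀ dw du → Pushed T sfn e dw du → P (child sq cp T e dw du)) →
                  All P (pushOne s t k sq cp T sfn e)
    pushOne-all sq cp T sfn e h with pushOne-cases sq cp T sfn e
    ... | inj₁ (_ , eq) = subst (All _) (sym eq) []
    ... | inj₂ (dw , du , cnd , eq) = subst (All _) (sym eq) (h dw du cnd ∷ [])

    pushOne-allPairs : ∀ {R : QEntry → QEntry → Set} sq cp T sfn e → AllPairs R (pushOne s t k sq cp T sfn e)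
    pushOne-allPairs sq cp T sfn e with pushOne-cases sq cp T sfn e
    ... | inj₁ (_ , eq) = subst (AllPairs _) (sym eq) []
    ... | inj₂ (dw , du , cnd , eq) = subst (AllPairs _) (sym eq) ([] ∷ [])

    pushAll-all : ∀ {P : QEntry → Set} sq cp T sfn → (∀ e dw du → Pushed T sfn e dw du → P (child sq cp T e dw du)) →
                  All P (pushAll s t k sq cp T sfn)
    pushAll-all sq cp T sfn h = concatMap-all (pushOne s t k sq cp T sfn) (allFin m) (λ e _ → pushOne-all sq cp T sfn e (h e))

    pushAll-allPairs : ∀ {R : QEntry → QEntry → Set} sq cp T sfn →
                 (∀ e1 e2 dw1 du1 dw2 du2 → e1 ≢ e2 → Pushed T sfn e1 dw1 du1 → Pushed T sfn e2 dw2 du2 →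
                    R (child sq cp T e1 dw1 du1) (child sq cp T e2 dw2 du2)) →
                 AllPairs R (pushAll s t k sq cp T sfn)
    pushAll-allPairs sq cp T sfn h = concatMap-allPairs (pushOne s t k sq cp T sfn) (allFin m) (UniqueP.allFin⁺ m)
      (pushOne-allPairs sq cp T sfn)
      (λ e1 e2 ne → pushOne-all sq cp T sfn e1 (λ dw1 du1 c1 → pushOne-all sq cp T sfn e2 (λ dw2 du2 c2 → h e1 e2 dw1 du1 dw2 du2 ne c1 c2)))

    module Extracted (Q₁ : List QEntry) (E : QEntry) (Q₂ : List QEntry) (out : List (List Edge))
                     (inv : Invariant (Q₁ ++ E ∷ Q₂) out) where
      open Invariant inv

      wellFormed-E : WellFormed E
      wellFormed-E = proj₁ (all-remove Q₁ wellFormed)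

      wellFormed-rest : All WellFormed (Q₁ ++ Q₂)
      wellFormed-rest = proj₂ (all-remove Q₁ wellFormed)

      fresh-E : FreshPrefix out E
      fresh-E = proj₁ (all-remove Q₁ fresh)

      fresh-rest : All (FreshPrefix out) (Q₁ ++ Q₂)
      fresh-rest = proj₂ (all-remove Q₁ fresh)

      incomparable-rest : AllPairs IncomparablePrefixes (Q₁ ++ Q₂)
      incomparable-rest = proj₁ (allPairs-remove (λ {x} {y} → incomparable-sym {x} {y}) Q₁ incomparable)

      incomparable-E : All (IncomparablePrefixes E) (Q₁ ++ Q₂)
      incomparable-E = proj₂ (allPairs-remove (λ {x} {y} → incomparable-sym {x} {y}) Q₁ incomparable)

    -- Step (i): the minimum entry E represents a simple path p, which is
    -- output, and the children for the sidetracks at nodes of suff(p) are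
    -- pushed.
    module SimpleCase (Q₁ Q₂ : List QEntry) (out : List (List Edge)) (sq : Sequence) (key : Carrier)
                      (inv : Invariant (Q₁ ++ (sq , key) ∷ Q₂) out) (W : WellFormed (sq , key))
                      (lt : length out <ℕ k) (mini : All (λ y → key ≤ proj₂ y) (Q₁ ++ Q₂))
                      (simp : Simple s (WellFormed.P W ++ WellFormed.sf W)) where
      open WellFormed W
      open Invariant inv
      open Extracted Q₁ (sq , key) Q₂ out inv

      p : List Edge
      p = P ++ sf
      cp : Carrier
      cp = cost p
      sfn : List Node
      sfn = nodes v sf
      PA : List QEntry
      PA = pushAll s t k sq cp T sfn
      out' : List (List Edge)
      out' = out ++ [ p ]


      split : ∀ e {dw du} → Pushed T sfn e dw du →
              ∃₂ λ a b → sf ≡ a ++ b × follow n T v (src e) ≡ just a × follow n T (src e) t ≡ just b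
      split e cnd = follow-split {x = v} {y = t} suffix≡ (Pushed.on-suffix cnd)

      pushed-wellFormed : ∀ e dw du → Pushed T sfn e dw du → WellFormed (child sq cp T e dw du)
      pushed-wellFormed e dw du cnd with split e cnd | bind-just (treePath s t k T (tgt e)) _ (Pushed.head-dist cnd)
      ... | a , b , sfeq , fa , fb | q' , tq' , _ = child-wellFormed W simp e dw du a b cnd sfeq fa fb q' tq'

      pushed-prefix : ∀ e dw du → Pushed T sfn e dw du → ∀ {P1} → devPrefix (sq ++ [ (e , T) ]) ≡ just P1 →
                 ∃₂ λ a b → sf ≡ a ++ b × follow n T (src e) t ≡ just b × P1 ≡ (P ++ a) ++ [ e ]
      pushed-prefix e dw du cnd d with split e cnd
      ... | a , b , sfeq , fa , fb = a , b , sfeq , fb , just-injective (trans (sym d) (prefixAlong-snoc T0 s sq e T (P ++ a) (extends (src e) a fa)))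

      reassoc : ∀ (a : List Edge) e r → ((P ++ a) ++ [ e ]) ++ r ≡ P ++ (a ++ e ∷ r)
      reassoc a e r = trans (LP.++-assoc (P ++ a) [ e ] r) (LP.++-assoc P a (e ∷ r))

      -- If a ++ e ∷ zs is a prefix of sf, then e is the tree edge at src e,
      -- hence no pushed sidetrack.
      tree-edge-not-sidetrack : ∀ a e zs b1 b2 → sf ≡ a ++ b1 → sf ≡ (a ++ e ∷ zs) ++ b2 →
                         follow n T (src e) t ≡ just b1 → T (src e) ≢ just e → ⊥
      tree-edge-not-sidetrack a e zs b1 b2 eq1 eq2 fb ne
        with LP.++-cancelˡ a b1 (e ∷ zs ++ b2) (trans (sym eq1) (trans eq2 (LP.++-assoc a (e ∷ zs) b2)))
      ... | refl with follow-∷ {n} {T} {src e} {t} fb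
      ... | _ , _ , _ , tx , _ = ne tx

      sidetracks-incomparable : ∀ a1 e1 r1 a2 e2 r2 b1 b2 → e1 ≢ e2 → sf ≡ a1 ++ b1 → sf ≡ a2 ++ b2 →
                       follow n T (src e1) t ≡ just b1 → follow n T (src e2) t ≡ just b2 →
                       T (src e1) ≢ just e1 → T (src e2) ≢ just e2 → a1 ++ e1 ∷ r1 ≡ a2 ++ e2 ∷ r2 → ⊥
      sidetracks-incomparable a1 e1 r1 a2 e2 r2 b1 b2 ne s1 s2 f1 f2 n1 n2 eq with ++-split a1 (e1 ∷ r1) a2 (e2 ∷ r2) eq
      ... | inj₁ ([] , _ , eq') = ne (proj₁ (LP.∷-injective eq'))
      ... | inj₁ (z ∷ zs , refl , eq') with LP.∷-injective eq'
      ...   | refl , _ = tree-edge-not-sidetrack a1 e1 zs b1 b2 s1 s2 f1 n1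
      sidetracks-incomparable a1 e1 r1 a2 e2 r2 b1 b2 ne s1 s2 f1 f2 n1 n2 eq | inj₂ ([] , _ , eq') = ne (sym (proj₁ (LP.∷-injective eq')))
      sidetracks-incomparable a1 e1 r1 a2 e2 r2 b1 b2 ne s1 s2 f1 f2 n1 n2 eq | inj₂ (z ∷ zs , refl , eq') with LP.∷-injective eq'
      ...   | refl , _ = tree-edge-not-sidetrack a2 e2 zs b2 b1 s2 s1 f2 n2

      -- p is not an earlier output, since E is fresh; it is no longer than
      -- any remaining simple path, since that is covered by an entry of key
      -- at least key E = c(p).
      length-out' : length out' ≡ suc (length out)
      length-out' = trans (LP.length-++ out) (NP.+-comm (length out) 1)

      outLen-simple : length out' ≤ℕ k
      outLen-simple = subst (_≤ℕ k) (sym length-out') lt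

      fewer-missing : k N.∸ length out' <ℕ k N.∸ length out
      fewer-missing = NP.∸-monoʳ-< (subst (length out <ℕ_) (sym length-out') (NP.n<1+n _)) outLen-simple

      p∉out : p ∉ out
      p∉out p∈ = fresh-E prefix≡ p p∈ sf refl

      outU-simple : Unique out'
      outU-simple = unique-snoc out outU p∉out

      outP-simple : All SimplePath out'
      outP-simple = AllP.++⁺ outP ((IsPath-++ P sf prefix-path (follow-path sp-tree sf suffix≡) , simp) ∷ [])

      outOptimal-simple : ∀ p₁ p' → p₁ ∈ out' → IsPath s p' t → Simple s p' → p' ∉ out' → cost p₁ ≤ cost p'
      outOptimal-simple p₁ p' p₁∈ ip sp p'∉ with ∈-snoc out p₁∈
      ... | inj₁ p₁∈o = outOptimal p₁ p' p₁∈o ip sp (λ m → p'∉ (MemP.∈-++⁺ˡ m))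
      ... | inj₂ refl with any-remove Q₁ (cover p' ip sp (λ m → p'∉ (MemP.∈-++⁺ˡ m)))
      ...   | inj₁ (_ , _ , le) = subst (_≤ cost p') key≡ le
      ...   | inj₂ a with all-any mini a
      ...     | E' , le1 , (_ , _ , le2) = subst (_≤ cost p') key≡ (≤-trans le1 le2)

      -- Children are fresh: their prefixes are not extended by earlier
      -- outputs (E is fresh), nor by p (the child leaves suff(p)).
      fresh-child : ∀ e dw du → Pushed T sfn e dw du → FreshPrefix out' (child sq cp T e dw du)
      fresh-child e dw du cnd d o o∈ rest eq with pushed-prefix e dw du cnd d
      ... | a , b , sfeq , fb , refl with ∈-snoc out o∈
      ...   | inj₁ o∈o = fresh-E prefix≡ o o∈o (a ++ e ∷ rest) (trans eq (reassoc a e rest))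
      ...   | inj₂ refl = tree-edge-not-sidetrack a e rest b [] sfeq sfeq2 fb (Pushed.sidetrack cnd)
        where
        sfeq2 : sf ≡ (a ++ e ∷ rest) ++ []
        sfeq2 = trans (LP.++-cancelˡ P sf (a ++ e ∷ rest) (trans eq (reassoc a e rest))) (sym (LP.++-identityʳ _))

      fresh-old : All (FreshPrefix out') (Q₁ ++ Q₂)
      fresh-old = All.tabulate still-fresh
        where
        still-fresh : ∀ {E'} → E' ∈ Q₁ ++ Q₂ → FreshPrefix out' E'
        still-fresh E'∈ d' o o∈ rest eq with ∈-snoc out o∈
        ... | inj₁ o∈o = All.lookup fresh-rest E'∈ d' o o∈o rest eq
        ... | inj₂ refl = All.lookup incomparable-E E'∈ prefix≡ d' sf rest eq

      -- Children extend E's prefix, so they are incomparable with the other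
      -- entries, and pairwise by sidetracks-incomparable.
      incomparable-children : AllPairs IncomparablePrefixes PA
      incomparable-children = pushAll-allPairs sq cp T sfn siblings-incomparable
        where
        siblings-incomparable : ∀ e1 e2 dw1 du1 dw2 du2 → e1 ≢ e2 → Pushed T sfn e1 dw1 du1 → Pushed T sfn e2 dw2 du2 →
              IncomparablePrefixes (child sq cp T e1 dw1 du1) (child sq cp T e2 dw2 du2)
        siblings-incomparable e1 e2 dw1 du1 dw2 du2 ne c1 c2 d1 d2 r1 r2 eq with pushed-prefix e1 dw1 du1 c1 d1 | pushed-prefix e2 dw2 du2 c2 d2
        ... | a1 , b1 , s1 , f1 , refl | a2 , b2 , s2 , f2 , refl =
          sidetracks-incomparable a1 e1 r1 a2 e2 r2 b1 b2 ne s1 s2 f1 f2 (Pushed.sidetrack c1) (Pushed.sidetrack c2)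
            (LP.++-cancelˡ P _ _ (trans (sym (reassoc a1 e1 r1)) (trans eq (reassoc a2 e2 r2))))

      incomparable-old-new : All (λ E' → All (IncomparablePrefixes E') PA) (Q₁ ++ Q₂)
      incomparable-old-new = All.tabulate λ E'∈ → pushAll-all sq cp T sfn (old-new-incomparable E'∈)
        where
        old-new-incomparable : ∀ {E'} → E' ∈ Q₁ ++ Q₂ → ∀ e dw du → Pushed T sfn e dw du → IncomparablePrefixes E' (child sq cp T e dw du)
        old-new-incomparable E'∈ e dw du cnd d' dch r' rch eq with pushed-prefix e dw du cnd dch
        ... | a , b , _ , _ , refl = All.lookup incomparable-E E'∈ prefix≡ d' (a ++ e ∷ rch) r' (sym (trans eq (reassoc a e rch)))

      beyond-avoids-U : ∀ rest a e' b' → Simple s (P ++ rest) → rest ≡ a ++ e' ∷ b' → All (_∉ U) (nodes (tgt e') b')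
      beyond-avoids-U rest a e' b' sp eq =
        All.tabulate λ z∈ z∈U → blocked _ z∈U rest sp (subst (λ r → _ ∈ nodes v r) (sym eq) (nodes-suffix v a e' b' z∈))

      -- The heart of the covering argument: p' = P ++ a ++ e' ∷ b' agrees
      -- with p along a up to the node u of suff(p), where it leaves the tree
      -- by the sidetrack e'.  The entry pushed for e' covers p': its key
      -- c(P ++ a ++ [e']) + d_T(tgt e') is at most c(p'), as T is an SimplePath
      -- tree of G - U and b' avoids U.
      sidetrack-covers : ∀ rest a u e' b' e'' sf₃ → Simple s (P ++ rest) →
        sf ≡ a ++ e'' ∷ sf₃ → rest ≡ a ++ e' ∷ b' → IsPath v a u → follow n T u t ≡ just (e'' ∷ sf₃) →
        src e' ≡ u → IsPath (tgt e') b' t → e' ≢ e'' → Any (Covers (P ++ rest)) PA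
      sidetrack-covers rest a u e' b' e'' sf₃ sp e1 e2 ipa fu su ipb ne'
        with follow-∷ {n} {T} {u} {t} fu | proj₁ (proj₂ sp-tree) (tgt e') (b' , ipb , beyond-avoids-U rest a e' b' sp e2)
      ... | _ , _ , u≢t , tu , _ | q'' , tq'' , _ , opt'' =
        concatMap-any (pushOne s t k sq cp T sfn) (allFin m) (MemP.∈-allFin e')
          (subst (Any (Covers (P ++ rest))) (sym (pushOne-in sq cp T sfn e' dw du cnd)) (here cov))
        where
        dw du : Carrier
        dw = cost q''
        du = cost (e'' ∷ sf₃)
        fu' : follow n T (src e') t ≡ just (e'' ∷ sf₃)
        fu' = subst (λ z → follow n T z t ≡ just (e'' ∷ sf₃)) (sym su) fu
        u∈ : u ∈ nodes v sf
        u∈ = subst (λ z → u ∈ nodes v z) (sym e1) (subst (u ∈_) (sym (nodes-++ v a (e'' ∷ sf₃))) (MemP.∈-++⁺ˡ (end∈nodes a ipa)))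
        cnd : Pushed T sfn e' dw du
        cnd = pushed (λ eq → ne' (just-injective (trans (sym (subst (λ z → T z ≡ just e') su eq)) tu)))
                     (subst (_∈ nodes v sf) (sym su) u∈)
                     (λ eq → u≢t (trans (sym su) eq))
                     (cong (λ z → z >>= λ q → just (cost q)) tq'')
                     (cong (λ z → z >>= λ q → just (cost q)) fu')
        cov : Covers (P ++ rest) (child sq cp T e' dw du)
        cov with split e' cnd
        ... | a* , b* , sfeq* , fa* , fb* with follow-det {x = src e'} {y = t} fb* fu'
        ... | refl with LP.++-cancelʳ (e'' ∷ sf₃) a* a (trans (sym sfeq*) e1)
        ... | refl = W' , (b' , eqp') , le
          where
          W' : WellFormed (child sq cp T e' dw du)
          W' = child-wellFormed W simp e' dw du a b* cnd sfeq* fa* fb* q'' tq''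
          X : List Edge
          X = (P ++ a) ++ [ e' ]
          eqp' : P ++ rest ≡ X ++ b'
          eqp' = trans (cong (P ++_) e2) (sym (reassoc a e' b'))
          le : proj₂ (child sq cp T e' dw du) ≤ cost (P ++ rest)
          le = subst (_≤ cost (P ++ rest)) (sym (WellFormed.key≡ W'))
                 (subst₂ _≤_ (sym (cost-++ X q'')) (trans (sym (cost-++ X b')) (cong cost (sym eqp')))
                   (+-monoʳ _ _ (cost X) (opt'' b' (ipb , beyond-avoids-U rest a e' b' sp e2))))

      -- Walk along p' and suff(p) while they agree; they cannot both end
      -- (p' ≠ p), nor can exactly one of them end (both end at t and p' is
      -- simple), so they part at a sidetrack.
      diverge : ∀ p' rest → IsPath s p' t → Simple s p' → p' ≡ P ++ rest → p' ≢ p → Any (Covers p') PA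
      diverge p' rest ip sp refl ne = walk [] v rest sf refl refl refl suffix≡ rest-path
        where
        rest-path : IsPath v rest t
        rest-path with IsPath-++⁻ P rest ip
        ... | y , ipP , ipr with IsPath-end P prefix-path ipP
        ... | refl = ipr
        walk : ∀ a u rest₂ sf₂ → sf ≡ a ++ sf₂ → rest ≡ a ++ rest₂ → IsPath v a u →
               follow n T u t ≡ just sf₂ → IsPath u rest₂ t → Any (Covers (P ++ rest)) PA
        walk a u [] [] e1 e2 ipa fu ipr = ⊥-elim (ne (cong (P ++_) (trans e2 (sym e1))))
        walk a u [] (e ∷ sf₃) e1 e2 ipa fu refl with follow-det {x = u} {y = u} (follow-refl n T u) fu
        ... | ()
        walk a u (e' ∷ b') [] e1 e2 ipa fu ipr with follow-[] {n} {T} {u} {t} fu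
        ... | refl = ⊥-elim (unique-++-disjoint (nodes s (P ++ a)) sp' (end∈nodes (P ++ a) (IsPath-++ P a prefix-path ipa))
                                                 (end∈nodes b' (proj₂ ipr)))
          where
          eqp : P ++ rest ≡ (P ++ a) ++ e' ∷ b'
          eqp = trans (cong (P ++_) e2) (sym (LP.++-assoc P a (e' ∷ b')))
          sp' : Unique (nodes s (P ++ a) ++ nodes (tgt e') b')
          sp' = subst Unique (nodes-split s (P ++ a) e' b') (subst (Simple s) eqp sp)
        walk a u (e' ∷ b') (e'' ∷ sf₃) e1 e2 ipa fu (su , ipb) with follow-∷ {n} {T} {u} {t} fu
        ... | g , n≡ , _ , _ , fg with e' ≟ e''
        ... | yes refl = walk (a ++ [ e' ]) (tgt e') b' sf₃
                (trans e1 (sym (LP.++-assoc a [ e' ] sf₃)))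
                (trans e2 (sym (LP.++-assoc a [ e' ] b')))
                (IsPath-++ a [ e' ] ipa (su , refl))
                (follow-mono {x = tgt e'} {y = t} (subst (g ≤ℕ_) (sym n≡) (NP.n≤1+n g)) fg)
                ipb
        ... | no ne' = sidetrack-covers rest a u e' b' e'' sf₃ sp e1 e2 ipa fu su ipb ne'

      cover' : ∀ p' → IsPath s p' t → Simple s p' → p' ∉ out' → Any (Covers p') (Q₁ ++ (Q₂ ++ PA))
      cover' p' ip sp p'∉ with any-remove Q₁ (cover p' ip sp (λ m → p'∉ (MemP.∈-++⁺ˡ m)))
      ... | inj₂ a = any-appendˡ Q₁ Q₂ PA a
      ... | inj₁ (W'' , (rest , eq) , _) = any-appendʳ Q₁ Q₂ PA (diverge p' rest ip sp eq' ne)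
        where
        eq' : p' ≡ P ++ rest
        eq' = trans eq (cong (_++ rest) (devPrefix-unique W (WellFormed.prefix≡ W'')))
        ne : p' ≢ p
        ne e = p'∉ (MemP.∈-++⁺ʳ out (here e))

      invariant-simple : Invariant (Q₁ ++ (Q₂ ++ PA)) out'
      invariant-simple = record
        { outLen = outLen-simple ; outU = outU-simple ; outP = outP-simple ; outOptimal = outOptimal-simple
        ; wellFormed = all-append Q₁ Q₂ PA wellFormed-rest (pushAll-all sq cp T sfn pushed-wellFormed)
        ; fresh = all-append Q₁ Q₂ PA fresh-old (pushAll-all sq cp T sfn fresh-child)
        ; incomparable = allPairs-append Q₁ Q₂ PA incomparable-rest incomparable-children incomparable-old-new
        ; cover = cover' }

    -- Step (ii): the minimum entry E = (ini ++ [(e , Te)] , key) represents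
    -- a non-simple walk; T' is an SP tree of G - pref(p), pref(p) = pr.

    module NonSimple (Q₁ Q₂ : List QEntry) (out : List (List Edge)) (ini : Sequence) (e : Edge) (Te : Tree) (key : Carrier)
                     (inv : Invariant (Q₁ ++ (ini ++ [ (e , Te) ] , key) ∷ Q₂) out)
                     (pr : List Edge) (upeq : upTo s t k T0 s ini (src e) ≡ just pr)
                     (T' : Tree) (spt' : SPTree s t k (nodes s pr) T') where
      open Invariant inv

      E : QEntry
      E = (ini ++ [ (e , Te) ] , key)
      open Extracted Q₁ E Q₂ out inv
      W : WellFormed E
      W = wellFormed-E

      prefix-E : devPrefix (ini ++ [ (e , Te) ]) ≡ just (pr ++ [ e ])
      prefix-E = prefixAlong-snoc T0 s ini e Te pr upeq

      covered-by-E : ∀ {p'} → Covers p' E → IsPath s p' t → Simple s p' →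
             ∃ λ rest → p' ≡ (pr ++ [ e ]) ++ rest × IsPath (tgt e) rest t ×
                        All (_∉ nodes s pr) (nodes (tgt e) rest) × tgt e ∉ nodes s pr
      covered-by-E {p'} (W'' , (rest , eq) , _) ip sp = rest , eq' , ipr , av , tn
        where
        eq' : p' ≡ (pr ++ [ e ]) ++ rest
        eq' = trans eq (cong (_++ rest) (sym (devPrefix-unique W'' prefix-E)))
        eq2 : p' ≡ pr ++ e ∷ rest
        eq2 = trans eq' (LP.++-assoc pr [ e ] rest)
        u : Unique (nodes s pr ++ nodes (tgt e) rest)
        u = subst Unique (nodes-split s pr e rest) (subst (Simple s) eq2 sp)
        av : All (_∉ nodes s pr) (nodes (tgt e) rest)
        av = All.tabulate λ z∈ z∈pr → unique-++-disjoint (nodes s pr) u z∈pr z∈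
        tn : tgt e ∉ nodes s pr
        tn m' = unique-++-disjoint (nodes s pr) u m' (here refl)
        ipr : IsPath (tgt e) rest t
        ipr with IsPath-++⁻ pr (e ∷ rest) (subst (λ z → IsPath s z t) eq2 ip)
        ... | _ , _ , (_ , ipr') = ipr'

      -- Discarding E is harmless: it covers no simple path, as tgt e is on
      -- pr or cannot reach t in G - pr.
      covers-nothing : (tgt e ∈ nodes s pr ⊎ dT s t k T' (tgt e) ≡ nothing) →
                       ∀ {p'} → Covers p' E → IsPath s p' t → Simple s p' → ⊥
      covers-nothing (inj₁ t∈) cv ip sp = proj₂ (proj₂ (proj₂ (proj₂ (covered-by-E cv ip sp)))) t∈
      covers-nothing (inj₂ dn) cv ip sp with covered-by-E cv ip sp
      ... | rest , _ , ipr , av , _ with proj₁ (proj₂ spt') (tgt e) (rest , ipr , av)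
      ...   | q , tq , _ = just≢nothing (trans (sym (cong (λ z → z >>= λ q → just (cost q)) tq)) dn)

      invariant-discard : (tgt e ∈ nodes s pr ⊎ dT s t k T' (tgt e) ≡ nothing) → Invariant (Q₁ ++ Q₂) out
      invariant-discard cond = record
        { outLen = outLen ; outU = outU ; outP = outP ; outOptimal = outOptimal
        ; wellFormed = wellFormed-rest ; fresh = fresh-rest ; incomparable = incomparable-rest ; cover = cover' }
        where
        cover' : ∀ p' → IsPath s p' t → Simple s p' → p' ∉ out → Any (Covers p') (Q₁ ++ Q₂)
        cover' p' ip sp p'∉ with any-remove Q₁ (cover p' ip sp p'∉)
        ... | inj₁ cv = ⊥-elim (covers-nothing cond cv ip sp)
        ... | inj₂ a = a

      -- Re-pushing E with the new tree T' and the key c(pr) + c(e) + d_T'(tgt e)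
      -- gives a well-formed entry representing a simple path, and it still
      -- covers what E covered, by optimality of T' in G - pr.
      module Repush (tn : tgt e ∉ nodes s pr) (d : Carrier) (deq : dT s t k T' (tgt e) ≡ just d) where
        qd : ∃ λ q → treePath s t k T' (tgt e) ≡ just q × just (cost q) ≡ just d
        qd = bind-just (treePath s t k T' (tgt e)) _ deq
        q : List Edge
        q = proj₁ qd
        tq : treePath s t k T' (tgt e) ≡ just q
        tq = proj₁ (proj₂ qd)
        d≡ : d ≡ cost q
        d≡ = sym (just-injective (proj₂ (proj₂ qd)))

        E' : QEntry
        E' = (ini ++ [ (e , T') ] , cost pr + c e + d)

        simp-pr : Simple s pr
        simp-pr with WellFormed.shape W
        ... | inj₁ (sqeq , _) = ⊥-elim (snoc≢[] ini sqeq)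
        ... | inj₂ (ini₀ , e₀ , Te₀ , pr₀ , sqeq , up₀ , simp₀) with LP.∷ʳ-injective ini ini₀ sqeq
        ...   | refl , refl with trans (sym upeq) up₀
        ...     | refl = simp₀

        v≡ : WellFormed.v W ≡ tgt e
        v≡ = cong proj₂ (trans (sym (WellFormed.last≡ W)) (lastInfo-snoc T0 s ini e Te))

        P≡ : WellFormed.P W ≡ pr ++ [ e ]
        P≡ = sym (devPrefix-unique W prefix-E)

        W' : WellFormed E'
        W' = record
          { T = T' ; v = tgt e ; U = nodes s pr ; P = pr ++ [ e ] ; sf = q
          ; last≡ = lastInfo-snoc T0 s ini e T'
          ; prefix≡ = prefixAlong-snoc T0 s ini e T' pr upeq
          ; extends = λ y r fr → trans (upTo-snoc T0 s ini e T' y pr r upeq fr) (cong just (sym (LP.++-assoc pr [ e ] r)))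
          ; suffix≡ = tq
          ; key≡ = keyeq
          ; prefix-path = subst₂ (IsPath s) P≡ v≡ (WellFormed.prefix-path W)
          ; sp-tree = spt'
          ; blocked = λ x x∈ rest sp z∈ → unique-++-disjoint (nodes s pr)
                       (subst Unique (nodes-split s pr e rest) (subst (Simple s) (LP.++-assoc pr [ e ] rest) sp)) x∈ z∈
          ; shape = inj₂ (ini , e , T' , pr , refl , upeq , simp-pr)
          }
          where
          keyeq : cost pr + c e + d ≡ cost ((pr ++ [ e ]) ++ q)
          keyeq = begin
              cost pr + c e + d          ≡⟨ cong (cost pr + c e +_) d≡ ⟩
              cost pr + c e + cost q     ≡⟨ +-assoc (cost pr) (c e) (cost q) ⟩
              cost pr + (c e + cost q)   ≡⟨ sym (cost-++ pr (e ∷ q)) ⟩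
              cost (pr ++ e ∷ q)         ≡⟨ cong cost (sym (LP.++-assoc pr [ e ] q)) ⟩
              cost ((pr ++ [ e ]) ++ q) ∎
            where open ≡-Reasoning

        prefix-E′ : ∀ {P1} → devPrefix (ini ++ [ (e , T') ]) ≡ just P1 → P1 ≡ pr ++ [ e ]
        prefix-E′ dd = just-injective (trans (sym dd) (prefixAlong-snoc T0 s ini e T' pr upeq))

        fresh-E′ : FreshPrefix out E'
        fresh-E′ dd o o∈ rest eq with prefix-E′ dd
        ... | refl = fresh-E prefix-E o o∈ rest eq

        incomparable-E′ : All (IncomparablePrefixes E') (Q₁ ++ Q₂)
        incomparable-E′ = All.tabulate like-E
          where
          like-E : ∀ {X} → X ∈ Q₁ ++ Q₂ → IncomparablePrefixes E' X
          like-E X∈ d1 d2 with prefix-E′ d1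
          ... | refl = All.lookup incomparable-E X∈ prefix-E d2

        cover' : ∀ p' → IsPath s p' t → Simple s p' → p' ∉ out → Any (Covers p') (Q₁ ++ (Q₂ ++ [ E' ]))
        cover' p' ip sp p'∉ with any-remove Q₁ (cover p' ip sp p'∉)
        ... | inj₂ a = any-appendˡ Q₁ Q₂ [ E' ] a
        ... | inj₁ cv with covered-by-E cv ip sp
        ...   | rest , eq , ipr , av , _ with proj₁ (proj₂ spt') (tgt e) (rest , ipr , av)
        ...     | q₂ , tq₂ , _ , opt with just-injective (trans (sym tq) tq₂)
        ...       | refl = any-appendʳ Q₁ Q₂ [ E' ] (here (W' , (rest , eq) , le))
          where
          X : List Edge
          X = pr ++ [ e ]
          le : cost pr + c e + d ≤ cost p'
          le = subst₂ _≤_ (sym (trans (WellFormed.key≡ W') (cost-++ X q))) (trans (sym (cost-++ X rest)) (cong cost (sym eq)))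
                 (+-monoʳ _ _ (cost X) (opt rest (ipr , av)))

        invariant-repush : Invariant (Q₁ ++ (Q₂ ++ [ E' ])) out
        invariant-repush = record
          { outLen = outLen ; outU = outU ; outP = outP ; outOptimal = outOptimal
          ; wellFormed = all-append Q₁ Q₂ [ E' ] wellFormed-rest (W' ∷ [])
          ; fresh = all-append Q₁ Q₂ [ E' ] fresh-rest (fresh-E′ ∷ [])
          ; incomparable = allPairs-append Q₁ Q₂ [ E' ] incomparable-rest ([] ∷ []) (All.map (λ {X} dx → incomparable-sym {E'} {X} dx ∷ []) incomparable-E′)
          ; cover = cover' }

        -- The new walk pr ++ e ∷ q is simple: q lies in G - pr.
        simple-new : Simple s ((pr ++ [ e ]) ++ q)
        simple-new = subst (Simple s) (sym (LP.++-assoc pr [ e ] q))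
          (subst Unique (sym (nodes-split s pr e q))
            (UniqueP.++⁺ simp-pr (follow-simple {x = tgt e} {y = t} q tq)
               (λ { (m1 , m2) → All.lookup (treePath-avoid spt' tq tn) m2 m1 })))

    -- The weight of an entry: 1 if it represents a simple path, else 2.
    -- Discarding lowers the queue weight by at least 1, re-pushing replaces
    -- weight 2 by weight 1.

    weight : Maybe (List Edge) → ℕ
    weight nothing = 2
    weight (just p) with simple? s (p)
    ... | yes _ = 1
    ... | no _ = 2

    entryWeight : QEntry → ℕ
    entryWeight E = weight (rep s t k T0 (proj₁ E))

    queueWeight : List QEntry → ℕ
    queueWeight [] = 0
    queueWeight (E ∷ Q) = entryWeight E N.+ queueWeight Q

    queueWeight-++ : ∀ xs ys → queueWeight (xs ++ ys) ≡ queueWeight xs N.+ queueWeight ys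
    queueWeight-++ [] ys = refl
    queueWeight-++ (x ∷ xs) ys = trans (cong (entryWeight x N.+_) (queueWeight-++ xs ys)) (sym (NP.+-assoc (entryWeight x) _ _))

    weight≥1 : ∀ mp → 1 ≤ℕ weight mp
    weight≥1 nothing = N.s≤s N.z≤n
    weight≥1 (just p) with simple? s (p)
    ... | yes _ = N.s≤s N.z≤n
    ... | no _ = N.s≤s N.z≤n

    weight-simple : ∀ p → Simple s p → weight (just p) ≡ 1
    weight-simple p sp with simple? s (p)
    ... | yes _ = refl
    ... | no ns = ⊥-elim (ns sp)

    weight-nonsimple : ∀ p → ¬ Simple s p → weight (just p) ≡ 2
    weight-nonsimple p ns with simple? s (p)
    ... | yes sp = ⊥-elim (ns sp)
    ... | no _ = refl

    discard-lighter : ∀ Q₁ E Q₂ → queueWeight (Q₁ ++ Q₂) <ℕ queueWeight (Q₁ ++ E ∷ Q₂)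
    discard-lighter Q₁ E Q₂ = subst₂ _<ℕ_ (sym (queueWeight-++ Q₁ Q₂)) (sym (queueWeight-++ Q₁ (E ∷ Q₂)))
      (NP.+-monoʳ-< (queueWeight Q₁) (NP.m<n+m (queueWeight Q₂) (weight≥1 (rep s t k T0 (proj₁ E)))))

    repush-lighter : ∀ Q₁ E Q₂ E' → entryWeight E ≡ 2 → entryWeight E' ≡ 1 → queueWeight (Q₁ ++ (Q₂ ++ [ E' ])) <ℕ queueWeight (Q₁ ++ E ∷ Q₂)
    repush-lighter Q₁ E Q₂ E' w2 w1 = begin-strict
        queueWeight (Q₁ ++ (Q₂ ++ [ E' ]))
          ≡⟨ trans (queueWeight-++ Q₁ _) (cong (w₁ N.+_) (queueWeight-++ Q₂ [ E' ])) ⟩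
        w₁ N.+ (w₂ N.+ (entryWeight E' N.+ 0))
          ≡⟨ cong (λ w → w₁ N.+ (w₂ N.+ (w N.+ 0))) w1 ⟩
        w₁ N.+ (w₂ N.+ 1)
          ≡⟨ cong (w₁ N.+_) (NP.+-comm w₂ 1) ⟩
        w₁ N.+ suc w₂
          <⟨ NP.+-monoʳ-< w₁ (NP.n<1+n (suc w₂)) ⟩
        w₁ N.+ (2 N.+ w₂)
          ≡⟨ cong (λ w → w₁ N.+ (w N.+ w₂)) (sym w2) ⟩
        w₁ N.+ queueWeight (E ∷ Q₂)
          ≡⟨ sym (queueWeight-++ Q₁ (E ∷ Q₂)) ⟩
        queueWeight (Q₁ ++ E ∷ Q₂) ∎
      where
      open NP.≤-Reasoning
      w₁ w₂ : ℕ
      w₁ = queueWeight Q₁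
      w₂ = queueWeight Q₂

    _<ₗ_ : ℕ × ℕ → ℕ × ℕ → Set
    _<ₗ_ = Lex.×-Lex _≡_ _<ℕ_ _<ℕ_

    μ : List QEntry → List (List Edge) → ℕ × ℕ
    μ Q out = (k N.∸ length out , queueWeight Q)

    step-preserves : ∀ {Q out Q' out'} → Invariant Q out → Step s t k T0 (st Q out) (st Q' out') →
                     Invariant Q' out' × μ Q' out' <ₗ μ Q out
    step-preserves inv (simple Q₁ Q₂ out sq key p sf lt mini repeq simp folleq) with proj₁ (all-remove Q₁ (Invariant.wellFormed inv))
    ... | W with just-injective (trans (sym repeq) (rep≡ W))
               | follow-det {x = WellFormed.v W} {y = t}
                   (subst (λ z → follow n (proj₁ z) (proj₂ z) t ≡ just sf) (WellFormed.last≡ W) folleq) (WellFormed.suffix≡ W)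
    ... | refl | refl rewrite WellFormed.last≡ W =
      S.invariant-simple , inj₁ S.fewer-missing
      where module S = SimpleCase Q₁ Q₂ out sq key inv W lt mini simp
    step-preserves inv (discard Q₁ Q₂ out ini e Te key p pr T lt mini repeq nsimp upeq sptT cond) =
      NonSimple.invariant-discard Q₁ Q₂ out ini e Te key inv pr upeq T sptT cond ,
      inj₂ (refl , discard-lighter Q₁ _ Q₂)
    step-preserves inv (repush Q₁ Q₂ out ini e Te key p pr T d lt mini repeq nsimp upeq sptT tn deq) =
      R.invariant-repush ,
      inj₂ (refl , repush-lighter Q₁ _ Q₂ _ (trans (cong weight repeq) (weight-nonsimple p nsimp))
                     (trans (cong weight (rep≡ R.W')) (weight-simple _ R.simple-new)))
      where module R = NonSimple.Repush Q₁ Q₂ out ini e Te key inv pr upeq T sptT tn d deq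

    module Runs (sp-trees : ∀ U → ∃ λ T → SPTree s t k U T)
                (k-paths : ∃ λ (PL : List (List Edge)) → length PL ≡ k × Unique PL × All SimplePath PL) where

      missing-path : ∀ out → length out <ℕ k → ∃ λ p → SimplePath p × p ∉ out
      missing-path out lt with All.all? (λ p → DecMem._∈?_ (LP.≡-dec _≟_) p out) PL
        where PL = proj₁ k-paths
      ... | yes all∈ = ⊥-elim (NP.<⇒≱ lt (subst (_≤ℕ length out) (proj₁ (proj₂ k-paths))
                        (ListFacts.unique⊆⇒length≤ _ out (proj₁ (proj₂ (proj₂ k-paths))) (All.lookup all∈))))
      ... | no ¬all with all-any (proj₂ (proj₂ (proj₂ k-paths)))
                                 (AllP.¬All⇒Any¬ (λ p → DecMem._∈?_ (LP.≡-dec _≟_) p out) _ ¬all)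
      ...   | p , sp , p∉ = p , sp , p∉

      process : ∀ {out} Q₁ sq key Q₂ → length out <ℕ k → All (λ y → key ≤ proj₂ y) (Q₁ ++ Q₂) → WellFormed (sq , key) →
                ∃ λ S' → Step s t k T0 (st (Q₁ ++ (sq , key) ∷ Q₂) out) S'
      process {out} Q₁ sq key Q₂ lt mini W with simple? s (WellFormed.P W ++ WellFormed.sf W)
      ... | yes simp = _ , simple Q₁ Q₂ out sq key (WellFormed.P W ++ WellFormed.sf W) (WellFormed.sf W) lt mini (rep≡ W) simp
                             (subst (λ z → follow n (proj₁ z) (proj₂ z) t ≡ just (WellFormed.sf W)) (sym (WellFormed.last≡ W)) (WellFormed.suffix≡ W))
      ... | no nsimp with WellFormed.shape W
      ...   | inj₁ (refl , _) = ⊥-elim (nsimp (follow-simple {x = s} {y = t} _ (rep≡ W)))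
      ...   | inj₂ (ini , e , Te , pr , refl , upeq , _) with sp-trees (nodes s pr)
      ...     | T' , sptT with tgt e ∈? nodes s pr
      ...       | yes t∈ = _ , discard Q₁ Q₂ out ini e Te key _ pr T' lt mini (rep≡ W) nsimp upeq sptT (inj₁ t∈)
      ...       | no tn with dT s t k T' (tgt e) in deq
      ...         | just d = _ , repush Q₁ Q₂ out ini e Te key _ pr T' d lt mini (rep≡ W) nsimp upeq sptT tn deq
      ...         | nothing = _ , discard Q₁ Q₂ out ini e Te key _ pr T' lt mini (rep≡ W) nsimp upeq sptT (inj₂ deq)

      -- The missing path is covered by some entry, so the queue is nonempty.
      progress : ∀ {Q out} → Invariant Q out → length out <ℕ k → ∃ λ S' → Step s t k T0 (st Q out) S'
      progress {Q} {out} inv lt with missing-path out lt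
      ... | p , (ip , sp) , p∉ = extract Q inv (Invariant.cover inv p ip sp p∉)
        where
        extract : ∀ Q → Invariant Q out → Any (Covers p) Q → ∃ λ S' → Step s t k T0 (st Q out) S'
        extract (E₀ ∷ Q₀) inv _ with minimum-split proj₂ E₀ Q₀
        ... | Q₁ , (sq , key) , Q₂ , eq , mini rewrite eq =
          process Q₁ sq key Q₂ lt mini (proj₁ (all-remove Q₁ (Invariant.wellFormed inv)))

      runs-correct : ∀ Q out → Acc _<ₗ_ (μ Q out) → Invariant Q out → AllRunsCorrect s t k T0 (st Q out)
      runs-correct Q out (acc smaller) inv with length out <? k
      ... | no ¬lt = done len (len , Invariant.outU inv , Invariant.outP inv , Invariant.outOptimal inv)
        where len = NP.≤-antisym (Invariant.outLen inv) (NP.≮⇒≥ ¬lt)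
      ... | yes lt = step lt (progress inv lt) after
        where
        after : ∀ S' → Step s t k T0 (st Q out) S' → AllRunsCorrect s t k T0 S'
        after (st Q' out') stp with step-preserves inv stp
        ... | invariant-simple , dec = runs-correct Q' out' (smaller dec) invariant-simple

      all-runs-correct : AllRunsCorrect s t k T0 (initState s t k p0)
      all-runs-correct = runs-correct [ root ] [] (Lex.×-wellFounded <-wellFounded <-wellFounded _) invariant₀

lemma1 : (ℝ : OrderedReals) (G : WGraph ℝ) (s t : Fin (WGraph.n G)) (k : ℕ) →
    let open OrderedReals ℝ
        open WGraph G
        open Alg ℝ G
    in (∀ e → 0# ≤ c e) →
       (∀ v → ∃ λ q → IsPath s q v) →
       (∀ v → ∃ λ q → IsPath v q t) →
       (∃ λ (P : List (List Edge)) →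
          length P ≡ k × Unique P × All (λ p → IsPath s p t × Simple s p) P) →
       (T0 : Tree) → SPTree s t k [] T0 →
       (p0 : List Edge) → treePath s t k T0 s ≡ just p0 →
       AllRunsCorrect s t k T0 (initState s t k p0)
lemma1 ℝ G s t k c≥0 _ _ k-paths T0 spt0 p0 p0eq = Runs.all-runs-correct sp-trees k-paths
  where
  open Graph ℝ G
  open Correctness s t k T0 spt0 p0 p0eq
  sp-trees : ∀ U → ∃ λ T → Alg.SPTree ℝ G s t k U T
  sp-trees U = Dijkstra.spTree-exists c≥0 s t k U
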